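{- Let $P_4$ be the path on 4 vertices. Then $W^*[P_4]=E[P_4]=3$.
   Context: Graphs are finite, simple, undirected, loopless. First-order sentences about graphs use only adjacency $\sim$ and equality $=$; the variable width of a sentence is its number of distinct variables. Write $F\sqsubset G$ if $G$ contains an induced copy of $F$. For non-isomorphic graphs $G,H$, $W(G,H)$ is the minimum variable width of a sentence true on one and false on the other; $W^*[F]=\max\{W(G,H):F\sqsubset G,\ F\not\sqsubset H\}$. For $k\ge2$, $\mathrm{EA}_k$ says: for all disjoint vertex sets $X,Y$ with $|X\cup Y|<k$ there is $z\notin X\cup Y$ adjacent to all of $X$ and to none of $Y$; $\mathrm{EA}_1$ says the graph is non-empty. The extension index $E[F]$ is the minimum $k$ such that every graph satisfying $\mathrm{EA}_k$ contains an induced copy of $F$. -}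

module Defs where

open import Data.Nat using (ℕ; zero; suc; _<_; _≤_; _≟_; _≡ᵇ_)
open import Data.Bool using (Bool; true; false; _∨_)
open import Data.Bool.Properties using (∨-comm)
open import Data.Fin using (Fin; toℕ)
open import Data.Fin.Subset using (Subset; _∈_; _∉_; _∪_; ∣_∣)
open import Data.Maybe using (Maybe; just; nothing)
open import Data.List using (List; []; _∷_; _++_; filter; length; deduplicate)
open import Data.Product using (Σ; _×_; _,_)
open import Data.Sum using (_⊎_)
open import Data.Empty using (⊥)
open import Data.Unit using (⊤)
open import Relation.Nullary using (¬_; ¬?)
open import Relation.Binary.PropositionalEquality using (_≡_; refl; cong₂)
open import Function using (Injective)

record Graph : Set where
  field
    n      : ℕ
    adj    : Fin n → Fin n → Bool
    sym    : ∀ i j → adj i j ≡ adj j i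
    irrefl : ∀ i → adj i i ≡ false
open Graph public

_⊏_ : Graph → Graph → Set
F ⊏ G = Σ (Fin (n F) → Fin (n G)) λ f →
          Injective _≡_ _≡_ f × (∀ i j → adj G (f i) (f j) ≡ adj F i j)

private
  ≡ᵇ-suc : ∀ m → (m ≡ᵇ suc m) ≡ false
  ≡ᵇ-suc zero = refl
  ≡ᵇ-suc (suc m) = ≡ᵇ-suc m

p4adj : Fin 4 → Fin 4 → Bool
p4adj i j = (toℕ i ≡ᵇ suc (toℕ j)) ∨ (toℕ j ≡ᵇ suc (toℕ i))

P4 : Graph
P4 = record
  { n = 4
  ; adj = p4adj
  ; sym = λ i j → ∨-comm (toℕ i ≡ᵇ suc (toℕ j)) (toℕ j ≡ᵇ suc (toℕ i))
  ; irrefl = λ i → cong₂ _∨_ (≡ᵇ-suc (toℕ i)) (≡ᵇ-suc (toℕ i))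
  }

Var : Set
Var = ℕ

data Formula : Set where
  _~'_ : Var → Var → Formula
  _≐_  : Var → Var → Formula
  ¬'_  : Formula → Formula
  _∧'_ : Formula → Formula → Formula
  _∨'_ : Formula → Formula → Formula
  ∃'   : Var → Formula → Formula
  ∀'   : Var → Formula → Formula

vars : Formula → List Var
vars (x ~' y) = x ∷ y ∷ []
vars (x ≐ y)  = x ∷ y ∷ []
vars (¬' φ)   = vars φ
vars (φ ∧' ψ) = vars φ ++ vars ψ
vars (φ ∨' ψ) = vars φ ++ vars ψ
vars (∃' x φ) = x ∷ vars φ
vars (∀' x φ) = x ∷ vars φ

width : Formula → ℕ
width φ = length (deduplicate _≟_ (vars φ))

fv : Formula → List Var
fv (x ~' y) = x ∷ y ∷ []
fv (x ≐ y)  = x ∷ y ∷ []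
fv (¬' φ)   = fv φ
fv (φ ∧' ψ) = fv φ ++ fv ψ
fv (φ ∨' ψ) = fv φ ++ fv ψ
fv (∃' x φ) = filter (λ y → ¬? (y ≟ x)) (fv φ)
fv (∀' x φ) = filter (λ y → ¬? (y ≟ x)) (fv φ)

Sentence : Formula → Set
Sentence φ = fv φ ≡ []

-- partial assignments (unassigned variables make atoms false;
-- irrelevant for sentences, but allows the empty graph)
Assign : ℕ → Set
Assign m = Var → Maybe (Fin m)

update : ∀ {m} → Assign m → Var → Fin m → Assign m
update ρ x v y with y ≟ x
... | Relation.Nullary.yes _ = just v
... | Relation.Nullary.no  _ = ρ y

AdjAt : (G : Graph) → Maybe (Fin (n G)) → Maybe (Fin (n G)) → Set
AdjAt G (just u) (just v) = adj G u v ≡ true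
AdjAt G _ _ = ⊥

EqAt : (G : Graph) → Maybe (Fin (n G)) → Maybe (Fin (n G)) → Set
EqAt G (just u) (just v) = u ≡ v
EqAt G _ _ = ⊥

Sat : (G : Graph) → Formula → Assign (n G) → Set
Sat G (x ~' y) ρ = AdjAt G (ρ x) (ρ y)
Sat G (x ≐ y)  ρ = EqAt G (ρ x) (ρ y)
Sat G (¬' φ)   ρ = ¬ Sat G φ ρ
Sat G (φ ∧' ψ) ρ = Sat G φ ρ × Sat G ψ ρ
Sat G (φ ∨' ψ) ρ = Sat G φ ρ ⊎ Sat G ψ ρ
Sat G (∃' x φ) ρ = Σ (Fin (n G)) λ v → Sat G φ (update ρ x v)
Sat G (∀' x φ) ρ = (v : Fin (n G)) → Sat G φ (update ρ x v)

_⊨_ : Graph → Formula → Set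
G ⊨ φ = Sat G φ (λ _ → nothing)

Distinguishes : Formula → Graph → Graph → Set
Distinguishes φ G H = ((G ⊨ φ) × ¬ (H ⊨ φ)) ⊎ (¬ (G ⊨ φ) × (H ⊨ φ))

W≤ : Graph → Graph → ℕ → Set
W≤ G H k = Σ Formula λ φ → Sentence φ × width φ ≤ k × Distinguishes φ G H

Disjoint : ∀ {m} → Subset m → Subset m → Set
Disjoint X Y = ∀ i → i ∈ X → i ∉ Y

EAge2 : ℕ → Graph → Set
EAge2 k G = (X Y : Subset (n G)) → Disjoint X Y → ∣ X ∪ Y ∣ < k →
  Σ (Fin (n G)) λ z → z ∉ X × z ∉ Y ×
    (∀ x → x ∈ X → adj G z x ≡ true) ×
    (∀ y → y ∈ Y → adj G z y ≡ false)

EA : ℕ → Graph → Set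
EA zero G = ⊤            -- not used (k ≥ 1 in the paper)
EA (suc zero) G = 0 < n G
EA (suc (suc k)) G = EAge2 (suc (suc k)) G

-- k has the property defining E[F] : every graph satisfying EA_k contains F
ForcesInduced : ℕ → Graph → Set
ForcesInduced k F = (G : Graph) → EA k G → F ⊏ G

-- Upper bound: either Spoiler wins the 3-pebble game on G and H, and his winning strategy is a
-- 3-variable sentence, or Duplicator survives forever. A surviving strategy can be restricted to the
-- component of a P4 vertex in G, or in the complement of G, which shrinks G; once the vertex set is
-- connected in G and in its complement, the strategy carries both connectivities over to the answers
-- in H, and Seinsche's lemma (no set of two or more vertices of a P4-free graph is connected in the
-- graph and in its complement) contradicts P4-freeness of H.
-- Lower bound: P4 and the P4-free graph 2K₂ both satisfy EA₂, and two-variable sentences cannot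
-- separate EA₂ graphs, since any atomic type of a vertex over one other vertex is realised in both.
-- Extension index: EA₃ makes a graph connected in itself and in its complement, so Seinsche's lemma
-- yields a P4, while K₁ and 2K₂ satisfy EA₁ and EA₂ without containing P4.

module Submission where

open import Defs
open import Data.Nat as ℕ using (ℕ; zero; suc; _≤_; _<_; z≤n; s≤s; _+_)
import Data.Nat.Properties as ℕₚ
open import Data.Bool using (Bool; true; false; not)
open import Data.Maybe as Maybe using (Maybe; just; nothing)
open import Data.Vec as Vec using (Vec; []; _∷_; _[_]≔_)
import Data.Bool.Properties as Boolₚ
import Data.Vec.Properties as Vecₚ
open import Data.Fin using (Fin; zero; suc; toℕ; fromℕ<)
open import Data.Fin.Patterns using (0F; 1F; 2F; 3F)
open import Data.Fin.Subset as Sub using (Subset; ⁅_⁆; _∪_; ∣_∣; _∉_) renaming (⊥ to ∅)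
import Data.Fin.Subset.Properties as Subsetₚ
open import Data.Fin.Properties using (any?; all?; pigeonhole; toℕ-fromℕ<; toℕ<n; injective⇒≤) renaming (_≟_ to _≟ᶠ_)
open import Data.List as List using (List; []; _∷_; length; filter; allFin; lookup; deduplicate)
open import Data.List.Properties using (length-filter; filter-some)
open import Data.List.Relation.Unary.All as All using (All; []; _∷_)
open import Data.List.Relation.Unary.All.Properties using (¬All⇒Any¬; ++⁺; ++⁻ˡ; ++⁻ʳ; deduplicate⁺)
open import Data.List.Relation.Unary.Unique.DecPropositional.Properties ℕ._≟_ using (deduplicate-!)
open import Data.List.Relation.Unary.Any using (here; there)
open import Data.List.Relation.Unary.AllPairs using (_∷_)
open import Data.List.Relation.Unary.Unique.Propositional using (Unique)
open import Data.List.Membership.Propositional using (_∈_; find; lose)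
open import Data.List.Membership.Propositional.Properties
  using (∈-lookup; ∈-allFin; ∈-filter⁻; ∈-map⁺; ∈-cartesianProduct⁺; ∈-cartesianProductWith⁺; ∈-deduplicate⁺)
open import Data.Product as Product using (Σ; ∃-syntax; _×_; _,_; proj₁; proj₂)
open import Data.Sum as Sum using (_⊎_; inj₁; inj₂; [_,_]′)
open import Data.Empty using (⊥; ⊥-elim)
open import Data.Unit using (⊤; tt)
open import Function using (_∘_; _⇔_; mk⇔; Equivalence)
open import Relation.Nullary using (Dec; yes; no; ¬_; contradiction)
open import Relation.Nullary.Decidable
  using (⌊_⌋; toWitness; toWitnessFalse; map′; _×-dec_; _⊎-dec_; _→-dec_; ¬?; decidable-stable)
open import Relation.Unary using (Pred; Decidable; _⊆_; U)
open import Relation.Unary.Properties using (U?)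
open import Level using (0ℓ)
open import Relation.Binary.PropositionalEquality
  using (_≡_; _≢_; refl; trans; cong; cong₂; subst; subst₂) renaming (sym to ≡-sym)

Unique-lookup-injective : ∀ {A : Set} {xs : List A} → Unique xs →
  ∀ i j → lookup xs i ≡ lookup xs j → i ≡ j
Unique-lookup-injective {xs = _ ∷ _} _ zero zero _ = refl
Unique-lookup-injective {xs = _ ∷ _} (x∉ ∷ _) zero (suc j) eq = contradiction eq (All.lookup x∉ (∈-lookup j))
Unique-lookup-injective {xs = _ ∷ _} (x∉ ∷ _) (suc i) zero eq = contradiction (≡-sym eq) (All.lookup x∉ (∈-lookup i))
Unique-lookup-injective {xs = _ ∷ _} (_ ∷ u) (suc i) (suc j) eq = cong suc (Unique-lookup-injective u i j eq)

Unique-bounded⇒length≤ : ∀ {k} {xs : List ℕ} → Unique xs → All (_< k) xs → length xs ≤ k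
Unique-bounded⇒length≤ {k} {xs} u bounded = decidable-stable (length xs ℕ.≤? k) too-long
  where
  index : Fin (length xs) → Fin k
  index i = fromℕ< (All.lookup bounded (∈-lookup i))
  index-injective : ∀ i j → index i ≡ index j → i ≡ j
  index-injective i j eq = Unique-lookup-injective u i j
    (trans (≡-sym (toℕ-fromℕ< _)) (trans (cong toℕ eq) (toℕ-fromℕ< _)))
  too-long : ¬ ¬ length xs ≤ k
  too-long long with i , j , i<j , eq ← pigeonhole (ℕₚ.≰⇒> long) index =
    ℕₚ.<⇒≢ i<j (cong toℕ (index-injective i j eq))

module _ {A : Set} {P Q : Pred A 0ℓ} (P? : Decidable P) (Q? : Decidable Q) (P⊆Q : P ⊆ Q) where

  length-filter-mono : ∀ xs → length (filter P? xs) ≤ length (filter Q? xs)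
  length-filter-mono [] = z≤n
  length-filter-mono (x ∷ xs) with P? x | Q? x
  ... | yes _ | yes _ = s≤s (length-filter-mono xs)
  ... | yes p | no ¬q = contradiction (P⊆Q p) ¬q
  ... | no _  | yes _ = ℕₚ.m≤n⇒m≤1+n (length-filter-mono xs)
  ... | no _  | no _  = length-filter-mono xs

  length-filter-strict : ∀ {a xs} → a ∈ xs → Q a → ¬ P a → length (filter P? xs) < length (filter Q? xs)
  length-filter-strict {xs = x ∷ xs} (here refl) q ¬p with P? x | Q? x
  ... | yes p | _     = contradiction p ¬p
  ... | no _  | yes _ = s≤s (length-filter-mono xs)
  ... | no _  | no ¬q = contradiction q ¬q
  length-filter-strict {xs = x ∷ xs} (there a∈xs) q ¬p with P? x | Q? x
  ... | yes _ | yes _ = s≤s (length-filter-strict a∈xs q ¬p)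
  ... | yes p | no ¬q = contradiction (P⊆Q p) ¬q
  ... | no _  | yes _ = ℕₚ.m≤n⇒m≤1+n (length-filter-strict a∈xs q ¬p)
  ... | no _  | no _  = length-filter-strict a∈xs q ¬p

module Stabilisation {A : Set} (xs : List A) (complete : ∀ a → a ∈ xs)
                     (P : ℕ → Pred A 0ℓ) (P? : ∀ r → Decidable (P r))
                     (P-step : ∀ r → P r ⊆ P (suc r)) where

  Stable : ℕ → Set
  Stable r = P (suc r) ⊆ P r

  stable-or-growing : ∀ m → Σ ℕ Stable ⊎ m ≤ length (filter (P? m) xs)
  stable-or-growing zero = inj₂ z≤n
  stable-or-growing (suc m) with stable-or-growing m
  ... | inj₁ stable = inj₁ stable
  ... | inj₂ growing with All.all? (λ a → P? (suc m) a →-dec P? m a) xs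
  ...   | yes saturated = inj₁ (m , λ {a} → All.lookup saturated (complete a))
  ...   | no ¬saturated with a , a∈xs , new ← find (¬All⇒Any¬ (λ a → P? (suc m) a →-dec P? m a) xs ¬saturated) =
    inj₂ (ℕₚ.≤-trans (s≤s growing) (length-filter-strict (P? m) (P? (suc m)) (P-step m) a∈xs
      (decidable-stable (P? (suc m) a) λ ¬p → new λ p → contradiction p ¬p)
      (λ p → new λ _ → p)))

  stabilises : Σ ℕ Stable
  stabilises with stable-or-growing (suc (length xs))
  ... | inj₁ stable = stable
  ... | inj₂ growing = contradiction (ℕₚ.≤-trans growing (length-filter (P? _) xs)) ℕₚ.1+n≰n

vectors : ∀ {A : Set} → List A → ∀ m → List (Vec A m)
vectors xs zero    = [] ∷ []
vectors xs (suc m) = List.cartesianProductWith _∷_ xs (vectors xs m)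

∈-vectors : ∀ {A : Set} {xs : List A} → (∀ a → a ∈ xs) → ∀ {m} (v : Vec A m) → v ∈ vectors xs m
∈-vectors complete []      = here refl
∈-vectors complete (a ∷ v) = ∈-cartesianProductWith⁺ _∷_ (complete a) (∈-vectors complete v)

module _ (K : Graph) where

  adjᶜ : Fin (n K) → Fin (n K) → Bool
  adjᶜ i j with i ≟ᶠ j
  ... | yes _ = false
  ... | no _  = not (adj K i j)

  adjᶜ-sym : ∀ i j → adjᶜ i j ≡ adjᶜ j i
  adjᶜ-sym i j with i ≟ᶠ j | j ≟ᶠ i
  ... | yes _   | yes _   = refl
  ... | yes i≡j | no j≢i  = contradiction (≡-sym i≡j) j≢i
  ... | no i≢j  | yes j≡i = contradiction (≡-sym j≡i) i≢j
  ... | no _    | no _    = cong not (sym K i j)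

  adjᶜ-irrefl : ∀ i → adjᶜ i i ≡ false
  adjᶜ-irrefl i with i ≟ᶠ i
  ... | yes _  = refl
  ... | no i≢i = contradiction refl i≢i

complement : Graph → Graph
complement K = record { n = n K ; adj = adjᶜ K ; sym = adjᶜ-sym K ; irrefl = adjᶜ-irrefl K }

module _ (K : Graph) where

  adj⇒≢ : ∀ {i j} → adj K i j ≡ true → i ≢ j
  adj⇒≢ {i} ij refl = contradiction (trans (≡-sym ij) (irrefl K i)) λ ()

  complement-edge⁺ : ∀ {i j} → i ≢ j → adj K i j ≡ false → adj (complement K) i j ≡ true
  complement-edge⁺ {i} {j} i≢j ij with i ≟ᶠ j
  ... | yes i≡j = contradiction i≡j i≢j
  ... | no _    = cong not ij

  complement-edge⁻ : ∀ {i j} → adj (complement K) i j ≡ true → i ≢ j × adj K i j ≡ false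
  complement-edge⁻ {i} {j} ij with i ≟ᶠ j
  complement-edge⁻ () | yes _
  ... | no i≢j = i≢j , trans (≡-sym (Boolₚ.not-involutive (adj K i j))) (cong not ij)

  complement-non-edge : ∀ {i j} → adj K i j ≡ true → adj (complement K) i j ≡ false
  complement-non-edge {i} {j} ij with i ≟ᶠ j
  ... | yes _ = refl
  ... | no _  = cong not ij

  complement-involutive : ∀ i j → adj (complement (complement K)) i j ≡ adj K i j
  complement-involutive i j with i ≟ᶠ j
  ... | yes refl = ≡-sym (irrefl K i)
  ... | no i≢j with i ≟ᶠ j
  ...   | yes i≡j = contradiction i≡j i≢j
  ...   | no _    = Boolₚ.not-involutive (adj K i j)

record IsP4 (K : Graph) (a b c d : Fin (n K)) : Set where
  field
    ab : adj K a b ≡ true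
    bc : adj K b c ≡ true
    cd : adj K c d ≡ true
    ac : adj K a c ≡ false
    bd : adj K b d ≡ false
    ad : adj K a d ≡ false

HasP4 : Graph → Set
HasP4 K = ∃[ a ] ∃[ b ] ∃[ c ] ∃[ d ] IsP4 K a b c d

IsP4? : ∀ K a b c d → Dec (IsP4 K a b c d)
IsP4? K a b c d = map′
  (λ (ab , bc , cd , ac , bd , ad) → record { ab = ab ; bc = bc ; cd = cd ; ac = ac ; bd = bd ; ad = ad })
  (λ P → let open IsP4 P in ab , bc , cd , ac , bd , ad)
  ((adj K a b Boolₚ.≟ true) ×-dec (adj K b c Boolₚ.≟ true) ×-dec (adj K c d Boolₚ.≟ true) ×-dec
   (adj K a c Boolₚ.≟ false) ×-dec (adj K b d Boolₚ.≟ false) ×-dec (adj K a d Boolₚ.≟ false))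

hasP4? : ∀ K → Dec (HasP4 K)
hasP4? K = any? λ a → any? λ b → any? λ c → any? λ d → IsP4? K a b c d

module _ {K : Graph} {a b c d} (P : IsP4 K a b c d) where
  open IsP4 P

  a≢c : a ≢ c
  a≢c refl = contradiction (trans (≡-sym cd) ad) λ ()

  b≢d : b ≢ d
  b≢d refl = contradiction (trans (≡-sym ab) ad) λ ()

  a≢d : a ≢ d
  a≢d refl = contradiction (trans (≡-sym (trans (sym K b a) ab)) bd) λ ()

  IsP4-complement : IsP4 (complement K) b d a c
  IsP4-complement = record
    { ab = complement-edge⁺ K b≢d bd
    ; bc = complement-edge⁺ K (a≢d ∘ ≡-sym) (trans (sym K d a) ad)
    ; cd = complement-edge⁺ K a≢c ac
    ; ac = complement-non-edge K (trans (sym K b a) ab)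
    ; bd = complement-non-edge K (trans (sym K d c) cd)
    ; ad = complement-non-edge K bc }

P4-free-complement : ∀ {K} → ¬ HasP4 K → ¬ HasP4 (complement K)
P4-free-complement {K} P4-free (a , b , c , d , P) =
  P4-free (b , d , a , c , record
    { ab = back ab ; bc = back bc ; cd = back cd ; ac = back ac ; bd = back bd ; ad = back ad })
  where
  open IsP4 (IsP4-complement P)
  back : ∀ {i j v} → adj (complement (complement K)) i j ≡ v → adj K i j ≡ v
  back {i} {j} = trans (≡-sym (complement-involutive K i j))

P4⊏⇒HasP4 : ∀ {K} → P4 ⊏ K → HasP4 K
P4⊏⇒HasP4 (f , _ , e) = f 0F , f 1F , f 2F , f 3F , record
  { ab = e 0F 1F ; bc = e 1F 2F ; cd = e 2F 3F ; ac = e 0F 2F ; bd = e 1F 3F ; ad = e 0F 3F }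

P4-twin-free : ∀ x y → (∀ z → p4adj x z ≡ p4adj y z) → x ≡ y
P4-twin-free = toWitness {a? = all? λ x → all? λ y → all? (λ z → p4adj x z Boolₚ.≟ p4adj y z) →-dec (x ≟ᶠ y)} tt

HasP4⇒P4⊏ : ∀ {K} → HasP4 K → P4 ⊏ K
HasP4⇒P4⊏ {K} (a , b , c , d , P) = f , f-injective , f-adj
  where
  open IsP4 P
  f : Fin 4 → Fin (n K)
  f 0F = a
  f 1F = b
  f 2F = c
  f 3F = d
  adj-flip : ∀ {x y v} → adj K x y ≡ v → adj K y x ≡ v
  adj-flip {x} {y} = trans (sym K y x)
  f-adj : ∀ i j → adj K (f i) (f j) ≡ p4adj i j
  f-adj 0F 0F = irrefl K a
  f-adj 0F 1F = ab
  f-adj 0F 2F = ac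
  f-adj 0F 3F = ad
  f-adj 1F 1F = irrefl K b
  f-adj 1F 2F = bc
  f-adj 1F 3F = bd
  f-adj 2F 2F = irrefl K c
  f-adj 2F 3F = cd
  f-adj 3F 3F = irrefl K d
  f-adj 1F 0F = adj-flip ab
  f-adj 2F 0F = adj-flip ac
  f-adj 3F 0F = adj-flip ad
  f-adj 2F 1F = adj-flip bc
  f-adj 3F 1F = adj-flip bd
  f-adj 3F 2F = adj-flip cd
  f-injective : ∀ {x y} → f x ≡ f y → x ≡ y
  f-injective {x} {y} fx≡fy = P4-twin-free x y λ z →
    trans (≡-sym (f-adj x z)) (trans (cong (λ v → adj K v (f z)) fx≡fy) (f-adj y z))

-- Connectivity and Seinsche's lemma

module Connectivity (K : Graph) (S : Pred (Fin (n K)) 0ℓ) (S? : Decidable S) where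

  Reach≤ : ℕ → Fin (n K) → Fin (n K) → Set
  Reach≤ zero    a x = x ≡ a × S a
  Reach≤ (suc k) a x = Reach≤ k a x ⊎ (S x × ∃[ y ] Reach≤ k a y × adj K y x ≡ true)

  Reach : Fin (n K) → Fin (n K) → Set
  Reach a x = ∃[ k ] Reach≤ k a x

  reach≤? : ∀ k a x → Dec (Reach≤ k a x)
  reach≤? zero    a x = (x ≟ᶠ a) ×-dec S? a
  reach≤? (suc k) a x = reach≤? k a x ⊎-dec (S? x ×-dec any? λ y → reach≤? k a y ×-dec (adj K y x Boolₚ.≟ true))

  Reach≤⇒S : ∀ k {a x} → Reach≤ k a x → S a × S x
  Reach≤⇒S zero    (refl , sa) = sa , sa
  Reach≤⇒S (suc k) (inj₁ r) = Reach≤⇒S k r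
  Reach≤⇒S (suc k) (inj₂ (sx , _ , r , _)) = proj₁ (Reach≤⇒S k r) , sx

  Reach⇒S : ∀ {a x} → Reach a x → S a × S x
  Reach⇒S (k , r) = Reach≤⇒S k r

  reach-refl : ∀ {a} → S a → Reach a a
  reach-refl sa = zero , refl , sa

  reach-step : ∀ {a y x} → Reach a y → S x → adj K y x ≡ true → Reach a x
  reach-step (k , r) sx yx = suc k , inj₂ (sx , _ , r , yx)

  reach-ind : ∀ (M : Pred (Fin (n K)) 0ℓ) {a} → M a →
              (∀ {y x} → M y → S x → adj K y x ≡ true → M x) → ∀ {x} → Reach a x → M x
  reach-ind M ma step (k , r) = go k r
    where
    go : ∀ k {x} → Reach≤ k _ x → M x
    go zero    (refl , _) = ma
    go (suc k) (inj₁ r) = go k r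
    go (suc k) (inj₂ (sx , _ , r , yx)) = step (go k r) sx yx

  reach-trans : ∀ {a y x} → Reach a y → Reach y x → Reach a x
  reach-trans ray = reach-ind (Reach _) ray reach-step

  reach-sym : ∀ {a x} → Reach a x → Reach x a
  reach-sym {a} rax = reach-ind (λ y → Reach y a) (reach-refl (proj₁ (Reach⇒S rax)))
    (λ ray sx yx → reach-trans (reach-step (reach-refl sx) (proj₁ (Reach⇒S ray)) (trans (sym K _ _) yx)) ray) rax

  Reach≤-saturated : ∀ {a r} → Reach≤ (suc r) a ⊆ Reach≤ r a → ∀ k → Reach≤ k a ⊆ Reach≤ r a
  Reach≤-saturated {a} {r} stable = lower
    where
    lift : ∀ k {y} → Reach≤ zero a y → Reach≤ k a y
    lift zero    r0 = r0
    lift (suc k) r0 = inj₁ (lift k r0)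
    lower : ∀ k {y} → Reach≤ k a y → Reach≤ r a y
    lower zero    r0 = lift r r0
    lower (suc k) (inj₁ rk) = lower k rk
    lower (suc k) (inj₂ (sy , z , rk , zy)) = stable (inj₂ (sy , z , lower k rk , zy))

  reach? : ∀ a x → Dec (Reach a x)
  reach? a x with Stabilisation.stabilises (allFin (n K)) ∈-allFin (λ k → Reach≤ k a) (λ k → reach≤? k a) (λ _ → inj₁)
  ... | r , stable with reach≤? r a x
  ...   | yes r≤ = yes (r , r≤)
  ...   | no ¬r≤ = no λ (k , k≤) → ¬r≤ (Reach≤-saturated stable k k≤)

  Connected : Set
  Connected = ∀ {x y} → S x → S y → Reach x y

  spans? : ∀ a → (∀ {x} → S x → Reach a x) ⊎ ∃[ x ] S x × ¬ Reach a x
  spans? a with any? (λ x → S? x ×-dec ¬? (reach? a x))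
  ... | yes missed = inj₂ missed
  ... | no ¬missed = inj₁ λ {x} sx → decidable-stable (reach? a x) λ ¬r → ¬missed (x , sx , ¬r)

  spanning⇒connected : ∀ {a} → (∀ {x} → S x → Reach a x) → Connected
  spanning⇒connected a⇝ sx sy = reach-trans (reach-sym (a⇝ sx)) (a⇝ sy)

filter-shrinks : ∀ {k m} {R S : Pred (Fin k) 0ℓ} (R? : Decidable R) (S? : Decidable S) → R ⊆ S →
  ∀ {x} → S x → ¬ R x → length (filter S? (allFin k)) ≤ suc m → length (filter R? (allFin k)) ≤ m
filter-shrinks R? S? R⊆S sx ¬rx small =
  ℕₚ.≤-pred (ℕₚ.≤-trans (length-filter-strict R? S? R⊆S (∈-allFin _) sx ¬rx) small)

_∖_ : ∀ {m} → Pred (Fin m) 0ℓ → Fin m → Pred (Fin m) 0ℓ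
(S ∖ v) x = S x × x ≢ v

_∖?_ : ∀ {m} {S : Pred (Fin m) 0ℓ} → Decidable S → ∀ v → Decidable (S ∖ v)
(S? ∖? v) x = S? x ×-dec ¬? (x ≟ᶠ v)

module _ {K : Graph} (P4-free : ¬ HasP4 K) {S : Pred (Fin (n K)) 0ℓ} (S? : Decidable S)
         (conn : Connectivity.Connected K S S?) (coconn : Connectivity.Connected (complement K) S S?)
         {v} (sv : S v) where
  private
    module C  = Connectivity K S S?
    module Cᶜ = Connectivity (complement K) S S?
    module C′ = Connectivity K (S ∖ v) (S? ∖? v)

  non-neighbour : ∀ {t} → (S ∖ v) t → ∃[ u ] (S ∖ v) u × adj K v u ≡ false
  non-neighbour {t} (st , t≢v) with any? (λ u → (S? ∖? v) u ×-dec (adj K v u Boolₚ.≟ false))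
  ... | yes found = found
  ... | no ¬found = contradiction (Cᶜ.reach-ind (_≡ v) refl isolated (coconn sv st)) t≢v
    where
    isolated : ∀ {y x} → y ≡ v → S x → adj (complement K) y x ≡ true → x ≡ v
    isolated refl sx vx with v≢x , v≁x ← complement-edge⁻ K vx =
      contradiction (_ , (sx , v≢x ∘ ≡-sym) , v≁x) ¬found

  neighbour-in-component : ∀ {x} → (S ∖ v) x → ∃[ w ] C′.Reach x w × adj K w v ≡ true
  neighbour-in-component {x} (sx , x≢v) with any? (λ w → C′.reach? x w ×-dec (adj K w v Boolₚ.≟ true))
  ... | yes found = found
  ... | no ¬found = contradiction refl (proj₂ (proj₂ (C′.Reach⇒S x⇝v)))
    where
    extend : ∀ {z w} → C′.Reach x z → S w → adj K z w ≡ true → C′.Reach x w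
    extend {z} {w} rz sw zw with w ≟ᶠ v
    ... | yes refl = contradiction (z , rz , zw) ¬found
    ... | no w≢v = C′.reach-step rz (sw , w≢v) zw
    x⇝v : C′.Reach x v
    x⇝v = C.reach-ind (C′.Reach x) (C′.reach-refl (sx , x≢v)) extend (conn sx sv)

  crossing-edge : ∀ {u w} → C′.Reach u w → adj K w v ≡ true → adj K u v ≡ false →
    ∃[ x ] ∃[ y ] C′.Reach u x × C′.Reach u y × adj K x y ≡ true × adj K x v ≡ true × adj K y v ≡ false
  crossing-edge {u} {w} ruw wv uv
    with any? (λ x → any? λ y → C′.reach? u x ×-dec C′.reach? u y ×-dec
                (adj K x y Boolₚ.≟ true) ×-dec (adj K x v Boolₚ.≟ true) ×-dec (adj K y v Boolₚ.≟ false))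
  ... | yes found = found
  ... | no ¬found = contradiction (trans (≡-sym uv) (proj₂ (C′.reach-ind M (ruw , wv) extend (C′.reach-sym ruw)))) λ ()
    where
    M : Pred (Fin (n K)) 0ℓ
    M z = C′.Reach u z × adj K z v ≡ true
    extend : ∀ {z y} → M z → (S ∖ v) y → adj K z y ≡ true → M y
    extend {z} {y} (rz , zv) sy zy with adj K y v in yv
    ... | true  = C′.reach-step rz sy zy , refl
    ... | false = contradiction (z , y , rz , C′.reach-step rz sy zy , zy , zv , yv) ¬found

  -- If S ∖ v were disconnected, the component of a non-neighbour u of v would contain an edge x–y
  -- with x ~ v ≁ y, and a neighbour z of v in another component would give the P4 y–x–v–z.
  P4-free-bi-connected-minus-vertex : C′.Connected
  P4-free-bi-connected-minus-vertex {t₁} {t₂} st₁ st₂ = decidable-stable (C′.reach? t₁ t₂) separated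
    where
    separated : ¬ ¬ C′.Reach t₁ t₂
    separated ¬r₁₂
      with u , su , vu ← non-neighbour st₁
      with w , ruw , wv ← neighbour-in-component su
      with x , y , rux , ruy , xy , xv , yv ← crossing-edge ruw wv (trans (sym K u v) vu) = escape
      where
      P4-through : ∀ {t} → (S ∖ v) t → ¬ C′.Reach u t → ⊥
      P4-through st ¬rut with z , rtz , zv ← neighbour-in-component st =
        P4-free (y , x , v , z , record
          { ab = trans (sym K y x) xy ; bc = xv ; cd = trans (sym K v z) zv
          ; ac = yv ; bd = apart rux ; ad = apart ruy })
        where
        apart : ∀ {q} → C′.Reach u q → adj K q z ≡ false
        apart {q} ruq with adj K q z in qz
        ... | false = refl
        ... | true  =
          contradiction (C′.reach-trans (C′.reach-step ruq (proj₂ (C′.Reach⇒S rtz)) qz) (C′.reach-sym rtz)) ¬rut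
      escape : ⊥
      escape with C′.reach? u t₁
      ... | no ¬ru₁  = P4-through st₁ ¬ru₁
      ... | yes ru₁ = P4-through st₂ λ ru₂ → ¬r₁₂ (C′.reach-trans (C′.reach-sym ru₁) ru₂)

Connected-complement² : ∀ {K S} (S? : Decidable S) → Connectivity.Connected K S S? →
                        Connectivity.Connected (complement (complement K)) S S?
Connected-complement² {K} S? conn sx sy =
  C.reach-ind (Cᶜᶜ.Reach _) (Cᶜᶜ.reach-refl sx)
    (λ {z} {w} r sw zw → Cᶜᶜ.reach-step r sw (trans (complement-involutive K z w) zw)) (conn sx sy)
  where
  module C   = Connectivity K _ S?
  module Cᶜᶜ = Connectivity (complement (complement K)) _ S?

connected-non-adjacent-pair⇒equal : ∀ {K S} (S? : Decidable S) → Connectivity.Connected K S S? →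
  ∀ {x y} → S x → S y → adj K y x ≡ false → (∀ {w} → (S ∖ y) w → w ≡ x) → x ≡ y
connected-non-adjacent-pair⇒equal {K} {S} S? conn {x} {y} sx sy y≁x only-x =
  C.reach-ind (_≡ y) refl stuck (conn sy sx)
  where
  module C = Connectivity K _ S?
  stuck : ∀ {z w} → z ≡ y → S w → adj K z w ≡ true → w ≡ y
  stuck {w = w} refl sw yw with w ≟ᶠ y
  ... | yes w≡y = w≡y
  ... | no w≢y = contradiction (trans (≡-sym yw) (subst (λ q → adj K y q ≡ false) (≡-sym (only-x (sw , w≢y))) y≁x)) λ ()

bi-connected-pair⇒equal : ∀ {K S} (S? : Decidable S) →
  Connectivity.Connected K S S? → Connectivity.Connected (complement K) S S? →
  ∀ {x y} → S x → S y → (∀ {w} → (S ∖ y) w → w ≡ x) → x ≡ y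
bi-connected-pair⇒equal {K} S? conn coconn {x} {y} sx sy only-x with adj K y x in yx
... | false = connected-non-adjacent-pair⇒equal S? conn sx sy yx only-x
... | true  = connected-non-adjacent-pair⇒equal S? coconn sx sy (complement-non-edge K yx) only-x

P4-free-bi-connected⇒subsingleton : ∀ {K} → ¬ HasP4 K → ∀ {S} (S? : Decidable S) →
  Connectivity.Connected K S S? → Connectivity.Connected (complement K) S S? →
  ∀ {x y} → S x → S y → x ≡ y
P4-free-bi-connected⇒subsingleton {K} P4-free S? conn coconn {x} {y} sx sy =
  decidable-stable (x ≟ᶠ y) (go _ S? ℕₚ.≤-refl conn coconn sx sy)
  where
  size : ∀ {S} → Decidable S → ℕ
  size S? = length (filter S? (allFin (n K)))
  go : ∀ m {S} (S? : Decidable S) → size S? ≤ m →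
       Connectivity.Connected K S S? → Connectivity.Connected (complement K) S S? →
       ∀ {x y} → S x → S y → ¬ x ≢ y
  go zero S? empty _ _ {x} sx _ _ = contradiction (ℕₚ.≤-trans (filter-some S? (lose (∈-allFin x) sx)) empty) λ ()
  go (suc m) {S} S? small conn coconn {x} {y} sx sy x≢y
    with any? (λ x′ → (S? ∖? y) x′ ×-dec ¬? (x′ ≟ᶠ x))
  ... | yes (x′ , sx′ , x′≢x) =
    go m (S? ∖? y) smaller
      (P4-free-bi-connected-minus-vertex P4-free S? conn coconn sy)
      (P4-free-bi-connected-minus-vertex (P4-free-complement P4-free) S? coconn (Connected-complement² S? conn) sy)
      (sx , x≢y) sx′ (x′≢x ∘ ≡-sym)
    where
    smaller : size (S? ∖? y) ≤ m
    smaller = filter-shrinks (S? ∖? y) S? proj₁ sy (λ (_ , y≢y) → y≢y refl) small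
  ... | no ¬x′ = x≢y (bi-connected-pair⇒equal S? conn coconn sx sy only-x)
    where
    only-x : ∀ {w} → (S ∖ y) w → w ≡ x
    only-x {w} sw = decidable-stable (w ≟ᶠ x) λ w≢x → ¬x′ (w , sw , w≢x)

-- First-order logic and the k-pebble game

update-cong : ∀ {m} {ρ σ : Assign m} → (∀ y → ρ y ≡ σ y) → ∀ x v y → update ρ x v y ≡ update σ x v y
update-cong ρ≗σ x v y with y ℕ.≟ x
... | yes _ = refl
... | no _  = ρ≗σ y

Sat-cong : ∀ K φ {ρ σ : Assign (n K)} → (∀ y → ρ y ≡ σ y) → Sat K φ ρ → Sat K φ σ
Sat-cong K (x ~' y) ρ≗σ s rewrite ρ≗σ x | ρ≗σ y = s
Sat-cong K (x ≐ y)  ρ≗σ s rewrite ρ≗σ x | ρ≗σ y = s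
Sat-cong K (¬' φ)   ρ≗σ s = s ∘ Sat-cong K φ (≡-sym ∘ ρ≗σ)
Sat-cong K (φ ∧' ψ) ρ≗σ (s , t) = Sat-cong K φ ρ≗σ s , Sat-cong K ψ ρ≗σ t
Sat-cong K (φ ∨' ψ) ρ≗σ (inj₁ s) = inj₁ (Sat-cong K φ ρ≗σ s)
Sat-cong K (φ ∨' ψ) ρ≗σ (inj₂ t) = inj₂ (Sat-cong K ψ ρ≗σ t)
Sat-cong K (∃' x φ) ρ≗σ (v , s) = v , Sat-cong K φ (update-cong ρ≗σ x v) s
Sat-cong K (∀' x φ) ρ≗σ s v = Sat-cong K φ (update-cong ρ≗σ x v) (s v)

-- The empty conjunction is the valid formula ¬ x ~ x, so that no new variable is used.
⋀ : ∀ {m} → Var → (Fin m → Formula) → Formula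
⋀ {zero}  x ψ = ¬' (x ~' x)
⋀ {suc m} x ψ = ψ zero ∧' ⋀ x (ψ ∘ suc)

module _ (K : Graph) where

  ⋀-intro : ∀ {m} x (ψ : Fin m → Formula) ρ → (∀ j → Sat K (ψ j) ρ) → Sat K (⋀ x ψ) ρ
  ⋀-intro {zero}  x ψ ρ _ with ρ x
  ... | just g  = λ gg → contradiction (trans (≡-sym gg) (irrefl K g)) λ ()
  ... | nothing = λ ()
  ⋀-intro {suc m} x ψ ρ sat = sat zero , ⋀-intro x (ψ ∘ suc) ρ (sat ∘ suc)

  ⋀-elim : ∀ {m} x (ψ : Fin m → Formula) ρ → Sat K (⋀ x ψ) ρ → ∀ j → Sat K (ψ j) ρ
  ⋀-elim {suc m} x ψ ρ (s , _) zero    = s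
  ⋀-elim {suc m} x ψ ρ (_ , s) (suc j) = ⋀-elim x (ψ ∘ suc) ρ s j

module _ {P : Pred Var 0ℓ} where

  ⋀-vars : ∀ {m} x (ψ : Fin m → Formula) → P x → (∀ j → All P (vars (ψ j))) → All P (vars (⋀ x ψ))
  ⋀-vars {zero}  x ψ px _ = px ∷ px ∷ []
  ⋀-vars {suc m} x ψ px all = ++⁺ (all zero) (⋀-vars x (ψ ∘ suc) px (all ∘ suc))

  ⋀-fv : ∀ {m} x (ψ : Fin m → Formula) → P x → (∀ j → All P (fv (ψ j))) → All P (fv (⋀ x ψ))
  ⋀-fv {zero}  x ψ px _ = px ∷ px ∷ []
  ⋀-fv {suc m} x ψ px all = ++⁺ (all zero) (⋀-fv x (ψ ∘ suc) px (all ∘ suc))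

width≤ : ∀ {k} φ → All (_< k) (vars φ) → width φ ≤ k
width≤ φ bounded = Unique-bounded⇒length≤ (deduplicate-! (vars φ)) (deduplicate⁺ ℕ._≟_ bounded)

-- Pebble pair i interprets variable i; variables from k on stay unassigned.
pebbleAt : ∀ {A : Set} {k} → Vec (Maybe A) k → Var → Maybe A
pebbleAt []      _       = nothing
pebbleAt (a ∷ _) zero    = a
pebbleAt (_ ∷ p) (suc x) = pebbleAt p x

module _ {A : Set} where

  pebbleAt-toℕ : ∀ {k} (p : Vec (Maybe A) k) i → pebbleAt p (toℕ i) ≡ Vec.lookup p i
  pebbleAt-toℕ (_ ∷ _) zero    = refl
  pebbleAt-toℕ (_ ∷ p) (suc i) = pebbleAt-toℕ p i

  pebbleAt-[]≔ : ∀ {k} (p : Vec (Maybe A) k) i s {y} → y ≢ toℕ i → pebbleAt (p [ i ]≔ s) y ≡ pebbleAt p y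
  pebbleAt-[]≔ (_ ∷ _) zero    s {zero}  y≢i = contradiction refl y≢i
  pebbleAt-[]≔ (_ ∷ _) zero    s {suc y} _   = refl
  pebbleAt-[]≔ (_ ∷ _) (suc i) s {zero}  _   = refl
  pebbleAt-[]≔ (_ ∷ p) (suc i) s {suc y} y≢i = pebbleAt-[]≔ p i s (y≢i ∘ cong suc)

  pebbleAt-replicate : ∀ k y → pebbleAt (Vec.replicate k (nothing {A = A})) y ≡ nothing
  pebbleAt-replicate zero    y       = refl
  pebbleAt-replicate (suc k) zero    = refl
  pebbleAt-replicate (suc k) (suc y) = pebbleAt-replicate k y

  update-pebbleAt : ∀ {k m} (f : A → Fin m) (p : Vec (Maybe A) k) i a y →
    update (Maybe.map f ∘ pebbleAt p) (toℕ i) (f a) y ≡ Maybe.map f (pebbleAt (p [ i ]≔ just a) y)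
  update-pebbleAt f p i a y with y ℕ.≟ toℕ i
  ... | yes refl rewrite pebbleAt-toℕ (p [ i ]≔ just a) i | Vecₚ.lookup∘update i p (just a) = refl
  ... | no y≢i   rewrite pebbleAt-[]≔ p i (just a) y≢i = refl

Sat-≐ : ∀ K {ρ : Assign (n K)} {x y u w} → ρ x ≡ just u → ρ y ≡ just w → Sat K (x ≐ y) ρ ⇔ (u ≡ w)
Sat-≐ K ρx ρy rewrite ρx | ρy = mk⇔ (λ e → e) (λ e → e)

Sat-~ : ∀ K {ρ : Assign (n K)} {x y u w} → ρ x ≡ just u → ρ y ≡ just w → Sat K (x ~' y) ρ ⇔ (adj K u w ≡ true)
Sat-~ K ρx ρy rewrite ρx | ρy = mk⇔ (λ e → e) (λ e → e)

All-filter-≢ : ∀ {P : Pred Var 0ℓ} x xs → All (λ y → y ≡ x ⊎ P y) xs → All P (filter (λ y → ¬? (y ℕ.≟ x)) xs)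
All-filter-≢ x xs all = All.tabulate λ y∈ → let y∈xs , y≢x = ∈-filter⁻ (λ y → ¬? (y ℕ.≟ x)) y∈ in
  [ (λ y≡x → contradiction y≡x y≢x) , (λ p → p) ]′ (All.lookup all y∈xs)

module PebbleGame (k : ℕ) (G H : Graph) where

  Pebble : Set
  Pebble = Maybe (Fin (n G) × Fin (n H))

  Position : Set
  Position = Vec Pebble k

  start : Position
  start = Vec.replicate k nothing

  place : Position → Fin k → Fin (n G) → Fin (n H) → Position
  place p i g h = p [ i ]≔ just (g , h)

  At : Position → Fin k → Fin (n G) → Fin (n H) → Set
  At p i g h = Vec.lookup p i ≡ just (g , h)

  Consistent : Pebble → Pebble → Set
  Consistent (just (g , h)) (just (g′ , h′)) = (g ≡ g′ → h ≡ h′) × (h ≡ h′ → g ≡ g′) × adj G g g′ ≡ adj H h h′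
  Consistent _ _ = ⊤

  consistent? : ∀ s t → Dec (Consistent s t)
  consistent? (just (g , h)) (just (g′ , h′)) =
    ((g ≟ᶠ g′) →-dec (h ≟ᶠ h′)) ×-dec ((h ≟ᶠ h′) →-dec (g ≟ᶠ g′)) ×-dec (adj G g g′ Boolₚ.≟ adj H h h′)
  consistent? (just _) nothing = yes tt
  consistent? nothing  _       = yes tt

  PartialIso : Position → Set
  PartialIso p = ∀ i j → Consistent (Vec.lookup p i) (Vec.lookup p j)

  partialIso? : ∀ p → Dec (PartialIso p)
  partialIso? p = all? λ i → all? λ j → consistent? (Vec.lookup p i) (Vec.lookup p j)

  SpoilerWins : ℕ → Position → Set
  SpoilerWins zero    p = ¬ PartialIso p
  SpoilerWins (suc r) p = SpoilerWins r p ⊎ ∃[ i ]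
    ((∃[ g ] ∀ h → SpoilerWins r (place p i g h)) ⊎ (∃[ h ] ∀ g → SpoilerWins r (place p i g h)))

  spoilerWins? : ∀ r p → Dec (SpoilerWins r p)
  spoilerWins? zero    p = ¬? (partialIso? p)
  spoilerWins? (suc r) p = spoilerWins? r p ⊎-dec any? λ i →
    (any? λ g → all? λ h → spoilerWins? r (place p i g h)) ⊎-dec (any? λ h → all? λ g → spoilerWins? r (place p i g h))

  ρG : Position → Assign (n G)
  ρG p x = Maybe.map proj₁ (pebbleAt p x)

  ρH : Position → Assign (n H)
  ρH p x = Maybe.map proj₂ (pebbleAt p x)


  ρG-place : ∀ p i g h y → update (ρG p) (toℕ i) g y ≡ ρG (place p i g h) y
  ρG-place p i g h = update-pebbleAt proj₁ p i (g , h)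

  ρH-place : ∀ p i g h y → update (ρH p) (toℕ i) h y ≡ ρH (place p i g h) y
  ρH-place p i g h = update-pebbleAt proj₂ p i (g , h)

  ρG-lookup : ∀ p i {g h} → At p i g h → ρG p (toℕ i) ≡ just g
  ρG-lookup p i pᵢ rewrite pebbleAt-toℕ p i | pᵢ = refl

  ρH-lookup : ∀ p i {g h} → At p i g h → ρH p (toℕ i) ≡ just h
  ρH-lookup p i pᵢ rewrite pebbleAt-toℕ p i | pᵢ = refl

  Pebbled : Position → Pred Var 0ℓ
  Pebbled p x = pebbleAt p x ≢ nothing

  record Separating (p : Position) : Set where
    field
      formula    : Formula
      bounded    : All (_< k) (vars formula)
      pebbled    : All (Pebbled p) (fv formula)
      true-in-G  : Sat G formula (ρG p)
      false-in-H : ¬ Sat H formula (ρH p)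

  Pebbled-lookup : ∀ p i {s} → Vec.lookup p i ≡ just s → Pebbled p (toℕ i)
  Pebbled-lookup p i pᵢ none = contradiction (trans (≡-sym pᵢ) (trans (≡-sym (pebbleAt-toℕ p i)) none)) λ ()

  separating-literal : ∀ p α → All (_< k) (vars α) → All (Pebbled p) (fv α) →
    (Sat G α (ρG p) × ¬ Sat H α (ρH p)) ⊎ (¬ Sat G α (ρG p) × Sat H α (ρH p)) → Separating p
  separating-literal p α bounded pebbled (inj₁ (α-G , ¬α-H)) = record
    { formula = α ; bounded = bounded ; pebbled = pebbled ; true-in-G = α-G ; false-in-H = ¬α-H }
  separating-literal p α bounded pebbled (inj₂ (¬α-G , α-H)) = record
    { formula = ¬' α ; bounded = bounded ; pebbled = pebbled ; true-in-G = ¬α-G ; false-in-H = λ ¬α → ¬α α-H }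

  module _ (p : Position) (i j : Fin k) {g h g′ h′} (pᵢ : At p i g h) (pⱼ : At p j g′ h′) where
    private
      atom : ∀ α → vars α ≡ toℕ i ∷ toℕ j ∷ [] → fv α ≡ toℕ i ∷ toℕ j ∷ [] →
        (Sat G α (ρG p) × ¬ Sat H α (ρH p)) ⊎ (¬ Sat G α (ρG p) × Sat H α (ρH p)) → Separating p
      atom α vars≡ fv≡ = separating-literal p α (subst (All (_< k)) (≡-sym vars≡) (toℕ<n i ∷ toℕ<n j ∷ []))
        (subst (All (Pebbled p)) (≡-sym fv≡) (Pebbled-lookup p i pᵢ ∷ Pebbled-lookup p j pⱼ ∷ []))
      ≐G : Sat G (toℕ i ≐ toℕ j) (ρG p) ⇔ (g ≡ g′)
      ≐G = Sat-≐ G {ρG p} (ρG-lookup p i pᵢ) (ρG-lookup p j pⱼ)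
      ≐H : Sat H (toℕ i ≐ toℕ j) (ρH p) ⇔ (h ≡ h′)
      ≐H = Sat-≐ H {ρH p} (ρH-lookup p i pᵢ) (ρH-lookup p j pⱼ)
      ~G : Sat G (toℕ i ~' toℕ j) (ρG p) ⇔ (adj G g g′ ≡ true)
      ~G = Sat-~ G {ρG p} (ρG-lookup p i pᵢ) (ρG-lookup p j pⱼ)
      ~H : Sat H (toℕ i ~' toℕ j) (ρH p) ⇔ (adj H h h′ ≡ true)
      ~H = Sat-~ H {ρH p} (ρH-lookup p i pᵢ) (ρH-lookup p j pⱼ)
      open Equivalence

      separating-adjacency : adj G g g′ ≢ adj H h h′ → Separating p
      separating-adjacency a≢b with adj G g g′ in a | adj H h h′ in b
      ... | true  | true  = contradiction refl a≢b
      ... | false | false = contradiction refl a≢b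
      ... | true  | false = atom (toℕ i ~' toℕ j) refl refl
        (inj₁ (from ~G a , λ s → contradiction (trans (≡-sym b) (to ~H s)) λ ()))
      ... | false | true  = atom (toℕ i ~' toℕ j) refl refl
        (inj₂ ((λ s → contradiction (trans (≡-sym a) (to ~G s)) λ ()) , from ~H b))

    separating-inconsistent : ¬ Consistent (just (g , h)) (just (g′ , h′)) → Separating p
    separating-inconsistent incons with g ≟ᶠ g′ | h ≟ᶠ h′
    ... | yes g≡g′ | no h≢h′  = atom (toℕ i ≐ toℕ j) refl refl (inj₁ (from ≐G g≡g′ , h≢h′ ∘ to ≐H))
    ... | no g≢g′  | yes h≡h′ = atom (toℕ i ≐ toℕ j) refl refl (inj₂ (g≢g′ ∘ to ≐G , from ≐H h≡h′))
    ... | yes g≡g′ | yes h≡h′ = separating-adjacency λ a≡b → incons ((λ _ → h≡h′) , (λ _ → g≡g′) , a≡b)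
    ... | no g≢g′  | no h≢h′  = separating-adjacency λ a≡b →
      incons ((λ g≡g′ → contradiction g≡g′ g≢g′) , (λ h≡h′ → contradiction h≡h′ h≢h′) , a≡b)

  separating-non-iso : ∀ p → ¬ PartialIso p → Separating p
  separating-non-iso p ¬iso with any? (λ i → any? λ j → ¬? (consistent? (Vec.lookup p i) (Vec.lookup p j)))
  ... | no consistent = contradiction
    (λ i j → decidable-stable (consistent? _ _) λ incons → consistent (i , j , incons)) ¬iso
  ... | yes (i , j , incons) with Vec.lookup p i in pᵢ | Vec.lookup p j in pⱼ
  ...   | just _  | just _  = separating-inconsistent p i j pᵢ pⱼ incons
  ...   | just _  | nothing = contradiction tt incons
  ...   | nothing | _       = contradiction tt incons

  Pebbled-place : ∀ p i g h y → Pebbled (place p i g h) y → y ≡ toℕ i ⊎ Pebbled p y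
  Pebbled-place p i g h y pebbled with y ℕ.≟ toℕ i
  ... | yes y≡i = inj₁ y≡i
  ... | no y≢i  = inj₂ (pebbled ∘ trans (pebbleAt-[]≔ p i _ y≢i))

  ∃⋀ : Fin k → ∀ {m} → (Fin m → Formula) → Formula
  ∃⋀ i ψ = ∃' (toℕ i) (⋀ (toℕ i) ψ)

  ∃⋀-bounded : ∀ i {m} (ψ : Fin m → Formula) → (∀ j → All (_< k) (vars (ψ j))) → All (_< k) (vars (∃⋀ i ψ))
  ∃⋀-bounded i ψ bounded = toℕ<n i ∷ ⋀-vars (toℕ i) ψ (toℕ<n i) bounded

  ∃⋀-pebbled : ∀ p i {m} (ψ : Fin m → Formula) (move : Fin m → Fin (n G) × Fin (n H)) →
    (∀ j → All (Pebbled (place p i (proj₁ (move j)) (proj₂ (move j)))) (fv (ψ j))) → All (Pebbled p) (fv (∃⋀ i ψ))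
  ∃⋀-pebbled p i ψ move pebbled =
    All-filter-≢ (toℕ i) _ (⋀-fv (toℕ i) ψ (inj₁ refl) λ j → All.map (Pebbled-place p i _ _ _) (pebbled j))

  open Separating

  separating-G-move : ∀ p i g → (∀ h → Separating (place p i g h)) → Separating p
  separating-G-move p i g sep = record
    { formula    = ∃⋀ i ψ
    ; bounded    = ∃⋀-bounded i ψ (bounded ∘ sep)
    ; pebbled    = ∃⋀-pebbled p i ψ (g ,_) (pebbled ∘ sep)
    ; true-in-G  = g , ⋀-intro G (toℕ i) ψ _ λ h → Sat-cong G (ψ h) (≡-sym ∘ ρG-place p i g h) (true-in-G (sep h))
    ; false-in-H = λ (h , s) → false-in-H (sep h) (Sat-cong H (ψ h) (ρH-place p i g h) (⋀-elim H (toℕ i) ψ _ s h))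
    }
    where
    ψ : Fin (n H) → Formula
    ψ = formula ∘ sep

  separating-H-move : ∀ p i h → (∀ g → Separating (place p i g h)) → Separating p
  separating-H-move p i h sep = record
    { formula    = ¬' ∃⋀ i (¬'_ ∘ ψ)
    ; bounded    = ∃⋀-bounded i (¬'_ ∘ ψ) (bounded ∘ sep)
    ; pebbled    = ∃⋀-pebbled p i (¬'_ ∘ ψ) (_, h) (pebbled ∘ sep)
    ; true-in-G  = λ (g , s) → ⋀-elim G (toℕ i) (¬'_ ∘ ψ) _ s g
                     (Sat-cong G (ψ g) (≡-sym ∘ ρG-place p i g h) (true-in-G (sep g)))
    ; false-in-H = λ ¬∃ → ¬∃ (h , ⋀-intro H (toℕ i) (¬'_ ∘ ψ) _ λ g s →
                     false-in-H (sep g) (Sat-cong H (ψ g) (ρH-place p i g h) s))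
    }
    where
    ψ : Fin (n G) → Formula
    ψ = formula ∘ sep

  spoilerWins⇒separating : ∀ r p → SpoilerWins r p → Separating p
  spoilerWins⇒separating zero    p ¬iso = separating-non-iso p ¬iso
  spoilerWins⇒separating (suc r) p (inj₁ win) = spoilerWins⇒separating r p win
  spoilerWins⇒separating (suc r) p (inj₂ (i , inj₁ (g , win))) =
    separating-G-move p i g λ h → spoilerWins⇒separating r _ (win h)
  spoilerWins⇒separating (suc r) p (inj₂ (i , inj₂ (h , win))) =
    separating-H-move p i h λ g → spoilerWins⇒separating r _ (win g)

  separating-start⇒W≤ : Separating start → W≤ G H k
  separating-start⇒W≤ sep =
    formula sep , sentence (fv (formula sep)) (pebbled sep) , width≤ (formula sep) (bounded sep) ,
    inj₁ (Sat-cong G (formula sep) ρG-start (true-in-G sep) , false-in-H sep ∘ Sat-cong H (formula sep) (≡-sym ∘ ρH-start))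
    where
    sentence : ∀ xs → All (Pebbled start) xs → xs ≡ []
    sentence []      _               = refl
    sentence (x ∷ _) (pebbled-x ∷ _) = contradiction (pebbleAt-replicate k x) pebbled-x
    ρG-start : ∀ x → ρG start x ≡ nothing
    ρG-start x rewrite pebbleAt-replicate {Fin (n G) × Fin (n H)} k x = refl
    ρH-start : ∀ x → ρH start x ≡ nothing
    ρH-start x rewrite pebbleAt-replicate {Fin (n G) × Fin (n H)} k x = refl

  spoilerWins⇒W≤ : ∀ r → SpoilerWins r start → W≤ G H k
  spoilerWins⇒W≤ r = separating-start⇒W≤ ∘ spoilerWins⇒separating r start

  Consistent-nothingʳ : ∀ s → Consistent s nothing
  Consistent-nothingʳ (just _) = tt
  Consistent-nothingʳ nothing  = tt

  partialIso-lift : ∀ p i → PartialIso p → PartialIso (p [ i ]≔ nothing)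
  partialIso-lift p i iso j l with j ≟ᶠ i | l ≟ᶠ i
  ... | yes refl | _        rewrite Vecₚ.lookup∘update i p nothing = tt
  ... | no _     | yes refl rewrite Vecₚ.lookup∘update i p nothing = Consistent-nothingʳ _
  ... | no j≢i   | no l≢i   rewrite Vecₚ.lookup∘update′ j≢i p nothing | Vecₚ.lookup∘update′ l≢i p nothing = iso j l

  spoilerWins-lift : ∀ r p i → SpoilerWins r (p [ i ]≔ nothing) → SpoilerWins r p
  spoilerWins-lift zero    p i win = win ∘ partialIso-lift p i
  spoilerWins-lift (suc r) p i (inj₁ win) = inj₁ (spoilerWins-lift r p i win)
  spoilerWins-lift (suc r) p i (inj₂ (j , inj₁ (g , win))) with i ≟ᶠ j
  ... | yes refl = inj₂ (i , inj₁ (g , λ h → subst (SpoilerWins r) (Vecₚ.[]≔-idempotent p i) (win h)))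
  ... | no i≢j   = inj₂ (j , inj₁ (g , λ h →
    spoilerWins-lift r _ i (subst (SpoilerWins r) (Vecₚ.[]≔-commutes p i j i≢j) (win h))))
  spoilerWins-lift (suc r) p i (inj₂ (j , inj₂ (h , win))) with i ≟ᶠ j
  ... | yes refl = inj₂ (i , inj₂ (h , λ g → subst (SpoilerWins r) (Vecₚ.[]≔-idempotent p i) (win g)))
  ... | no i≢j   = inj₂ (j , inj₂ (h , λ g →
    spoilerWins-lift r _ i (subst (SpoilerWins r) (Vecₚ.[]≔-commutes p i j i≢j) (win g))))

  spoilerWins-weaken : ∀ r {p} → SpoilerWins zero p → SpoilerWins r p
  spoilerWins-weaken zero    win = win
  spoilerWins-weaken (suc r) win = inj₁ (spoilerWins-weaken r win)

  record DuplicatorStrategy (S : Pred (Fin (n G)) 0ℓ) (T : Pred (Fin (n H)) 0ℓ) : Set₁ where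
    field
      Safe        : Pred Position 0ℓ
      safe-start  : Safe start
      safe-iso    : ∀ {p} → Safe p → PartialIso p
      safe-inside : ∀ {p} → Safe p → ∀ i {g h} → At p i g h → S g × T h
      forth       : ∀ {p} → Safe p → ∀ i g → S g → ∃[ h ] T h × Safe (place p i g h)
      back        : ∀ {p} → Safe p → ∀ i h → T h → ∃[ g ] S g × Safe (place p i g h)
      lift        : ∀ {p} → Safe p → ∀ i → Safe (p [ i ]≔ nothing)

  losing-positions-strategy : ∀ {r} → SpoilerWins (suc r) ⊆ SpoilerWins r → ¬ SpoilerWins r start →
                              DuplicatorStrategy U U
  losing-positions-strategy {r} stable lost = record
    { Safe        = λ p → ¬ SpoilerWins r p
    ; safe-start  = lost
    ; safe-iso    = λ {p} safe → decidable-stable (partialIso? p) (safe ∘ spoilerWins-weaken r)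
    ; safe-inside = λ _ _ _ → tt , tt
    ; forth       = λ {p} safe i g _ → answer-forth safe i g
    ; back        = λ {p} safe i h _ → answer-back safe i h
    ; lift        = λ {p} safe i → safe ∘ spoilerWins-lift r p i
    }
    where
    answer-forth : ∀ {p} → ¬ SpoilerWins r p → ∀ i g → ∃[ h ] ⊤ × ¬ SpoilerWins r (place p i g h)
    answer-forth {p} safe i g with any? (λ h → ¬? (spoilerWins? r (place p i g h)))
    ... | yes (h , safe′) = h , tt , safe′
    ... | no ¬safe = contradiction (stable (inj₂ (i , inj₁ (g , λ h →
      decidable-stable (spoilerWins? r _) λ safe′ → ¬safe (h , safe′))))) safe
    answer-back : ∀ {p} → ¬ SpoilerWins r p → ∀ i h → ∃[ g ] ⊤ × ¬ SpoilerWins r (place p i g h)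
    answer-back {p} safe i h with any? (λ g → ¬? (spoilerWins? r (place p i g h)))
    ... | yes (g , safe′) = g , tt , safe′
    ... | no ¬safe = contradiction (stable (inj₂ (i , inj₂ (h , λ g →
      decidable-stable (spoilerWins? r _) λ safe′ → ¬safe (g , safe′))))) safe

  pebbles : List Pebble
  pebbles = nothing ∷ List.map just (List.cartesianProduct (allFin (n G)) (allFin (n H)))

  ∈-pebbles : ∀ s → s ∈ pebbles
  ∈-pebbles nothing        = here refl
  ∈-pebbles (just (g , h)) = there (∈-map⁺ just (∈-cartesianProduct⁺ (∈-allFin g) (∈-allFin h)))

  W≤-or-duplicatorStrategy : W≤ G H k ⊎ DuplicatorStrategy U U
  W≤-or-duplicatorStrategy
    with r , stable ← Stabilisation.stabilises (vectors pebbles k) (∈-vectors ∈-pebbles)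
                                                SpoilerWins spoilerWins? (λ _ → inj₁)
    with spoilerWins? r start
  ... | yes win = inj₁ (spoilerWins⇒W≤ r win)
  ... | no lost = inj₂ (losing-positions-strategy stable lost)

-- The three-pebble game against a P4-free graph

lookup-ext : ∀ {A : Set} {k} {xs ys : Vec A k} → (∀ i → Vec.lookup xs i ≡ Vec.lookup ys i) → xs ≡ ys
lookup-ext {xs = xs} {ys} eq =
  trans (≡-sym (Vecₚ.tabulate∘lookup xs)) (trans (Vecₚ.tabulate-cong eq) (Vecₚ.tabulate∘lookup ys))

lift-anchor : ∀ {A : Set} {k} (p : Vec (Maybe A) k) i j x y → j ≢ i → (∀ l → l ≢ i → Vec.lookup p l ≡ nothing) →
  ((Vec.replicate k nothing [ j ]≔ x) [ i ]≔ y) [ j ]≔ nothing ≡ p [ i ]≔ y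
lift-anchor {k = k} p i j x y j≢i empty = lookup-ext λ l → entry l (l ≟ᶠ j) (l ≟ᶠ i)
  where
  s₁ = Vec.replicate k nothing [ j ]≔ x
  s₂ = s₁ [ i ]≔ y
  entry : ∀ l → Dec (l ≡ j) → Dec (l ≡ i) → Vec.lookup (s₂ [ j ]≔ nothing) l ≡ Vec.lookup (p [ i ]≔ y) l
  entry l (yes refl) (yes refl) = contradiction refl j≢i
  entry l (yes refl) (no l≢i) =
    trans (Vecₚ.lookup∘update l s₂ nothing) (≡-sym (trans (Vecₚ.lookup∘update′ l≢i p y) (empty l l≢i)))
  entry l (no l≢j) (yes refl) =
    trans (Vecₚ.lookup∘update′ l≢j s₂ nothing) (trans (Vecₚ.lookup∘update l s₁ y) (≡-sym (Vecₚ.lookup∘update l p y)))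
  entry l (no l≢j) (no l≢i) =
    trans (Vecₚ.lookup∘update′ l≢j s₂ nothing) (trans (Vecₚ.lookup∘update′ l≢i s₁ y)
      (trans (Vecₚ.lookup∘update′ l≢j (Vec.replicate k nothing) x) (trans (Vecₚ.lookup-replicate l nothing)
        (≡-sym (trans (Vecₚ.lookup∘update′ l≢i p y) (empty l l≢i))))))

occupied? : ∀ {A : Set} (s : Maybe A) → Dec (∃[ a ] s ≡ just a)
occupied? (just a) = yes (a , refl)
occupied? nothing  = no λ ()

third-pebble : ∀ (i j : Fin 3) → i ≢ j → ∃[ l ] l ≢ i × l ≢ j
third-pebble = toWitness {a? = all? λ i → all? λ j → ¬? (i ≟ᶠ j) →-dec any? λ l → ¬? (l ≟ᶠ i) ×-dec ¬? (l ≟ᶠ j)} tt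

another-pebble : ∀ (i : Fin 3) → ∃[ j ] j ≢ i
another-pebble = toWitness {a? = all? λ i → any? λ j → ¬? (j ≟ᶠ i)} tt

module Restriction (G H : Graph) {S : Pred (Fin (n G)) 0ℓ} {T : Pred (Fin (n H)) 0ℓ}
                   (S? : Decidable S) (T? : Decidable T) where
  open PebbleGame 3 G H
  private
    module CG = Connectivity G S S?
    module CH = Connectivity H T T?

  module _ (D : DuplicatorStrategy S T) where
    open DuplicatorStrategy D

    reach-forth : ∀ {p} → Safe p → ∀ i j → i ≢ j → ∀ {g h g′ h′} →
      At p i g h → At p j g′ h′ → CG.Reach g g′ → CH.Reach h h′
    reach-forth {p} safe i j i≢j {g} {h} pᵢ pⱼ g⇝g′ =
      proj₂ (CG.reach-ind M (proj₁ (CG.Reach⇒S g⇝g′) , origin) step g⇝g′) safe j (i≢j ∘ ≡-sym) pᵢ pⱼ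
      where
      M : Pred (Fin (n G)) 0ℓ
      M y = S y × ∀ {q} → Safe q → ∀ j → j ≢ i → ∀ {y′} → At q i g h → At q j y y′ → CH.Reach h y′
      origin : ∀ {q} → Safe q → ∀ j → j ≢ i → ∀ {y′} → At q i g h → At q j g y′ → CH.Reach h y′
      origin safe j _ qᵢ qⱼ with h≡y′ , _ ← subst₂ Consistent qᵢ qⱼ (safe-iso safe i j) =
        subst (CH.Reach h) (h≡y′ refl) (CH.reach-refl (proj₂ (safe-inside safe i qᵢ)))
      step : ∀ {y x} → M y → S x → adj G y x ≡ true → M x
      step {y} {x} (sy , reach-y) sx yx = sx , λ {q} safe j j≢i {x′} qᵢ qⱼ →
        let l , l≢i , l≢j = third-pebble i j (j≢i ∘ ≡-sym)
            y′ , ty′ , safe′ = forth safe l y sy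
            q′ᵢ = trans (Vecₚ.lookup∘update′ (l≢i ∘ ≡-sym) q _) qᵢ
            q′ⱼ = trans (Vecₚ.lookup∘update′ (l≢j ∘ ≡-sym) q _) qⱼ
            q′ₗ = Vecₚ.lookup∘update l q (just (y , y′))
            _ , _ , yx≡y′x′ = subst₂ Consistent q′ₗ q′ⱼ (safe-iso safe′ l j)
        in CH.reach-step (reach-y safe′ l l≢i q′ᵢ q′ₗ) (proj₂ (safe-inside safe j qⱼ)) (trans (≡-sym yx≡y′x′) yx)

    reach-back : ∀ {p} → Safe p → ∀ i j → i ≢ j → ∀ {g h g′ h′} →
      At p i g h → At p j g′ h′ → CH.Reach h h′ → CG.Reach g g′
    reach-back {p} safe i j i≢j {g} {h} pᵢ pⱼ h⇝h′ =
      proj₂ (CH.reach-ind M (proj₁ (CH.Reach⇒S h⇝h′) , origin) step h⇝h′) safe j (i≢j ∘ ≡-sym) pᵢ pⱼ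
      where
      M : Pred (Fin (n H)) 0ℓ
      M y′ = T y′ × ∀ {q} → Safe q → ∀ j → j ≢ i → ∀ {y} → At q i g h → At q j y y′ → CG.Reach g y
      origin : ∀ {q} → Safe q → ∀ j → j ≢ i → ∀ {y} → At q i g h → At q j y h → CG.Reach g y
      origin safe j _ qᵢ qⱼ with _ , g≡y , _ ← subst₂ Consistent qᵢ qⱼ (safe-iso safe i j) =
        subst (CG.Reach g) (g≡y refl) (CG.reach-refl (proj₁ (safe-inside safe i qᵢ)))
      step : ∀ {y′ x′} → M y′ → T x′ → adj H y′ x′ ≡ true → M x′
      step {y′} {x′} (ty′ , reach-y′) tx′ y′x′ = tx′ , λ {q} safe j j≢i {x} qᵢ qⱼ →
        let l , l≢i , l≢j = third-pebble i j (j≢i ∘ ≡-sym)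
            y , sy , safe′ = back safe l y′ ty′
            q′ᵢ = trans (Vecₚ.lookup∘update′ (l≢i ∘ ≡-sym) q _) qᵢ
            q′ⱼ = trans (Vecₚ.lookup∘update′ (l≢j ∘ ≡-sym) q _) qⱼ
            q′ₗ = Vecₚ.lookup∘update l q (just (y , y′))
            _ , _ , yx≡y′x′ = subst₂ Consistent q′ₗ q′ⱼ (safe-iso safe′ l j)
        in CG.reach-step (reach-y′ safe′ l l≢i q′ᵢ q′ₗ) (proj₁ (safe-inside safe j qⱼ)) (trans yx≡y′x′ y′x′)

    occupant : ∀ (p : Position) i →
      (∃[ j ] j ≢ i × ∃[ gh ] Vec.lookup p j ≡ just gh) ⊎ (∀ j → j ≢ i → Vec.lookup p j ≡ nothing)
    occupant p i with any? (λ j → ¬? (j ≟ᶠ i) ×-dec occupied? (Vec.lookup p j))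
    ... | yes found = inj₁ found
    ... | no ¬found = inj₂ λ j j≢i → vacant j j≢i (Vec.lookup p j) refl
      where
      vacant : ∀ j → j ≢ i → ∀ s → Vec.lookup p j ≡ s → Vec.lookup p j ≡ nothing
      vacant j j≢i nothing  pⱼ = pⱼ
      vacant j j≢i (just gh) pⱼ = contradiction (j , j≢i , gh , pⱼ) ¬found

    module Component {a} (sa : S a) where
      private
        opening : ∃[ h ] T h × Safe (place start 0F a h)
        opening = forth safe-start 0F a sa

      a′ : Fin (n H)
      a′ = proj₁ opening

      anchored : ∀ j → Safe (start [ j ]≔ just (a , a′))
      anchored 0F = proj₂ (proj₂ opening)
      anchored (suc j) with a″ , _ , safe″ ← forth (anchored 0F) (suc j) a sa
                       with a′≡a″ , _ ← subst (Consistent (just (a , a′)))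
                                          (Vecₚ.lookup∘update (suc j) (start [ 0F ]≔ just (a , a′)) (just (a , a″)))
                                          (safe-iso safe″ 0F (suc j)) =
        subst (λ b → Safe (start [ suc j ]≔ just (a , b))) (≡-sym (a′≡a″ refl)) (lift safe″ 0F)

      Cᴳ : Pred (Fin (n G)) 0ℓ
      Cᴳ = CG.Reach a

      Cᴳ? : Decidable Cᴳ
      Cᴳ? = CG.reach? a

      Cᴳ-smaller : ∀ {m x} → length (filter S? (allFin (n G))) ≤ suc m → S x → ¬ Cᴳ x →
                   length (filter Cᴳ? (allFin (n G))) ≤ m
      Cᴳ-smaller small sx ¬a⇝x = filter-shrinks Cᴳ? S? (proj₂ ∘ CG.Reach⇒S) sx ¬a⇝x small

      Cᴴ : Pred (Fin (n H)) 0ℓ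
      Cᴴ = CH.Reach a′

      Cᴴ? : Decidable Cᴴ
      Cᴴ? = CH.reach? a′

      Inside : Pred Position 0ℓ
      Inside p = ∀ i {g h} → At p i g h → Cᴳ g × Cᴴ h

      inside-place : ∀ {p} → Inside p → ∀ i {g h} → Cᴳ g → Cᴴ h → Inside (place p i g h)
      inside-place {p} inside i cg ch j pⱼ with j ≟ᶠ i
      ... | yes refl with refl ← trans (≡-sym (Vecₚ.lookup∘update j p _)) pⱼ = cg , ch
      ... | no j≢i = inside j (trans (≡-sym (Vecₚ.lookup∘update′ j≢i p _)) pⱼ)

      inside-lift : ∀ {p} → Inside p → ∀ i → Inside (p [ i ]≔ nothing)
      inside-lift {p} inside i j pⱼ with j ≟ᶠ i
      ... | yes refl = contradiction (trans (≡-sym (Vecₚ.lookup∘update j p _)) pⱼ) λ ()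
      ... | no j≢i = inside j (trans (≡-sym (Vecₚ.lookup∘update′ j≢i p _)) pⱼ)

      inside-start : Inside start
      inside-start i startᵢ = contradiction (trans (≡-sym (Vecₚ.lookup-replicate i nothing)) startᵢ) λ ()

      -- With no other pebble on the board, the anchor (a, a′) is put on a spare pebble to walk from.
      forth-inside : ∀ {p} → Safe p → Inside p → ∀ i g → Cᴳ g → ∃[ h ] Cᴴ h × Safe (place p i g h)
      forth-inside {p} safe inside i g a⇝g with occupant p i
      ... | inj₁ (j , j≢i , (g₀ , h₀) , pⱼ) =
        let h , _ , safe′ = forth safe i g (proj₂ (CG.Reach⇒S a⇝g))
            a⇝g₀ , a′⇝h₀ = inside j pⱼ
            h₀⇝h = reach-forth safe′ j i j≢i (trans (Vecₚ.lookup∘update′ j≢i p _) pⱼ) (Vecₚ.lookup∘update i p _)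
                     (CG.reach-trans (CG.reach-sym a⇝g₀) a⇝g)
        in h , CH.reach-trans a′⇝h₀ h₀⇝h , safe′
      ... | inj₂ vacant =
        let j , j≢i = another-pebble i
            h , _ , safe′ = forth (anchored j) i g (proj₂ (CG.Reach⇒S a⇝g))
            anchor = start [ j ]≔ just (a , a′)
            a′⇝h = reach-forth safe′ j i j≢i (trans (Vecₚ.lookup∘update′ j≢i anchor _) (Vecₚ.lookup∘update j start _))
                     (Vecₚ.lookup∘update i anchor _) a⇝g
        in h , a′⇝h , subst Safe (lift-anchor p i j _ _ j≢i vacant) (lift safe′ j)

      back-inside : ∀ {p} → Safe p → Inside p → ∀ i h → Cᴴ h → ∃[ g ] Cᴳ g × Safe (place p i g h)
      back-inside {p} safe inside i h a′⇝h with occupant p i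
      ... | inj₁ (j , j≢i , (g₀ , h₀) , pⱼ) =
        let g , _ , safe′ = back safe i h (proj₂ (CH.Reach⇒S a′⇝h))
            a⇝g₀ , a′⇝h₀ = inside j pⱼ
            g₀⇝g = reach-back safe′ j i j≢i (trans (Vecₚ.lookup∘update′ j≢i p _) pⱼ) (Vecₚ.lookup∘update i p _)
                     (CH.reach-trans (CH.reach-sym a′⇝h₀) a′⇝h)
        in g , CG.reach-trans a⇝g₀ g₀⇝g , safe′
      ... | inj₂ vacant =
        let j , j≢i = another-pebble i
            g , _ , safe′ = back (anchored j) i h (proj₂ (CH.Reach⇒S a′⇝h))
            anchor = start [ j ]≔ just (a , a′)
            a⇝g = reach-back safe′ j i j≢i (trans (Vecₚ.lookup∘update′ j≢i anchor _) (Vecₚ.lookup∘update j start _))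
                    (Vecₚ.lookup∘update i anchor _) a′⇝h
        in g , a⇝g , subst Safe (lift-anchor p i j _ _ j≢i vacant) (lift safe′ j)

      component-strategy : DuplicatorStrategy Cᴳ Cᴴ
      component-strategy = record
        { Safe        = λ p → Safe p × Inside p
        ; safe-start  = safe-start , inside-start
        ; safe-iso    = safe-iso ∘ proj₁
        ; safe-inside = proj₂
        ; forth       = λ {p} (safe , inside) i g a⇝g →
            let h , a′⇝h , safe′ = forth-inside safe inside i g a⇝g
            in h , a′⇝h , safe′ , inside-place {p} inside i a⇝g a′⇝h
        ; back        = λ {p} (safe , inside) i h a′⇝h →
            let g , a⇝g , safe′ = back-inside safe inside i h a′⇝h
            in g , a⇝g , safe′ , inside-place {p} inside i a⇝g a′⇝h
        ; lift        = λ {p} (safe , inside) i → lift safe i , inside-lift {p} inside i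
        }

    connected-transfer : CG.Connected → CH.Connected
    connected-transfer conn {t₁} {t₂} tt₁ tt₂ =
      let s₁ , ss₁ , safe₁ = back safe-start 0F t₁ tt₁
          s₂ , ss₂ , safe₂ = back safe₁ 1F t₂ tt₂
      in reach-forth safe₂ 0F 1F (λ ()) refl refl (conn ss₁ ss₂)

    distinct-responses : ∀ {a b} → S a → S b → a ≢ b → ∃[ a′ ] ∃[ b′ ] T a′ × T b′ × a′ ≢ b′
    distinct-responses {a} {b} sa sb a≢b =
      let a′ , ta′ , safe₁ = forth safe-start 0F a sa
          b′ , tb′ , safe₂ = forth safe₁ 1F b sb
          _ , reflect , _ = safe-iso safe₂ 0F 1F
      in a′ , b′ , ta′ , tb′ , a≢b ∘ reflect

module _ (G H : Graph) where
  private
    module P  = PebbleGame 3 G H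
    module Pᶜ = PebbleGame 3 (complement G) (complement H)

  Consistent-complement : ∀ s t → P.Consistent s t → Pᶜ.Consistent s t
  Consistent-complement (just (g , h)) (just (g′ , h′)) (to , from , g~g′≡h~h′) = to , from , adjᶜ≡
    where
    adjᶜ≡ : adjᶜ G g g′ ≡ adjᶜ H h h′
    adjᶜ≡ with g ≟ᶠ g′ | h ≟ᶠ h′
    ... | yes _    | yes _    = refl
    ... | yes g≡g′ | no h≢h′  = contradiction (to g≡g′) h≢h′
    ... | no g≢g′  | yes h≡h′ = contradiction (from h≡h′) g≢g′
    ... | no _     | no _     = cong not g~g′≡h~h′
  Consistent-complement (just _) nothing _ = tt
  Consistent-complement nothing  _       _ = tt

  complement-strategy : ∀ {S T} → P.DuplicatorStrategy S T → Pᶜ.DuplicatorStrategy S T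
  complement-strategy D = record
    { Safe = Safe ; safe-start = safe-start ; safe-inside = safe-inside ; forth = forth ; back = back ; lift = lift
    ; safe-iso = λ safe i j → Consistent-complement _ _ (safe-iso safe i j) }
    where open P.DuplicatorStrategy D

HasP4Within : (K : Graph) → Pred (Fin (n K)) 0ℓ → Set
HasP4Within K S = ∃[ a ] ∃[ b ] ∃[ c ] ∃[ d ] IsP4 K a b c d × S a × S b × S c × S d

no-duplicator-strategy : ∀ m {G H S T} (S? : Decidable S) (T? : Decidable T) →
  length (filter S? (allFin (n G))) ≤ m → PebbleGame.DuplicatorStrategy 3 G H S T →
  HasP4Within G S → ¬ HasP4 H → ⊥
no-duplicator-strategy zero S? T? small D (a , _ , _ , _ , _ , sa , _) P4-free =
  contradiction (ℕₚ.≤-trans (filter-some S? (lose (∈-allFin a) sa)) small) λ ()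
no-duplicator-strategy (suc m) {G} {H} {S} {T} S? T? small D (a , b , c , d , P , sa , sb , sc , sd) P4-free
  with Connectivity.spans? G S S? a | Connectivity.spans? (complement G) S S? a
... | inj₂ (x , sx , ¬a⇝x) | _ =
  no-duplicator-strategy m Cᴳ? Cᴴ? (Cᴳ-smaller small sx ¬a⇝x) component-strategy
    (a , b , c , d , P , a⇝a , a⇝b , a⇝c , CG.reach-step a⇝c sd cd) P4-free
  where
  module CG = Connectivity G S S?
  open Restriction.Component G H S? T? D sa
  open IsP4 P
  a⇝a = CG.reach-refl sa
  a⇝b = CG.reach-step a⇝a sb ab
  a⇝c = CG.reach-step a⇝b sc bc
... | inj₁ _ | inj₂ (x , sx , ¬a⇝x) =
  no-duplicator-strategy m Cᴳ? Cᴴ? (Cᴳ-smaller small sx ¬a⇝x) component-strategy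
    (b , d , a , c , IsP4-complement P , a⇝b , a⇝d , CG.reach-refl sa , a⇝c) (P4-free-complement P4-free)
  where
  module CG = Connectivity (complement G) S S?
  open Restriction.Component (complement G) (complement H) S? T? (complement-strategy G H D) sa
  open IsP4 (IsP4-complement P)
  a⇝c = CG.reach-step (CG.reach-refl sa) sc cd
  a⇝d = CG.reach-step (CG.reach-refl sa) sd (trans (sym (complement G) a d) bc)
  a⇝b = CG.reach-step a⇝d sb (trans (sym (complement G) d b) ab)
... | inj₁ a⇝ | inj₁ a⇝ᶜ
  with a′ , b′ , ta′ , tb′ , a′≢b′ ← Restriction.distinct-responses G H S? T? D sa sb (adj⇒≢ G (IsP4.ab P)) =
  a′≢b′ (P4-free-bi-connected⇒subsingleton P4-free T?
    (Restriction.connected-transfer G H S? T? D (Connectivity.spanning⇒connected G S S? a⇝))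
    (Restriction.connected-transfer (complement G) (complement H) S? T? (complement-strategy G H D)
      (Connectivity.spanning⇒connected (complement G) S S? a⇝ᶜ))
    ta′ tb′)

P4-vs-P4-free⇒W≤3 : ∀ G H → P4 ⊏ G → ¬ P4 ⊏ H → W≤ G H 3
P4-vs-P4-free⇒W≤3 G H P4⊏G P4⊄H with PebbleGame.W≤-or-duplicatorStrategy 3 G H
... | inj₁ W≤3 = W≤3
... | inj₂ D with a , b , c , d , P ← P4⊏⇒HasP4 P4⊏G =
  ⊥-elim (no-duplicator-strategy _ U? U? ℕₚ.≤-refl D (a , b , c , d , P , tt , tt , tt , tt) (P4⊄H ∘ HasP4⇒P4⊏))

-- Extension axioms and two-variable logic

∣p∪q∣≤∣p∣+∣q∣ : ∀ {m} (p q : Subset m) → ∣ p ∪ q ∣ ≤ ∣ p ∣ + ∣ q ∣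
∣p∪q∣≤∣p∣+∣q∣ []            []            = z≤n
∣p∪q∣≤∣p∣+∣q∣ (Sub.inside ∷ p)  (Sub.inside ∷ q)  =
  s≤s (ℕₚ.≤-trans (∣p∪q∣≤∣p∣+∣q∣ p q) (ℕₚ.+-monoʳ-≤ ∣ p ∣ (ℕₚ.n≤1+n ∣ q ∣)))
∣p∪q∣≤∣p∣+∣q∣ (Sub.inside ∷ p)  (Sub.outside ∷ q) = s≤s (∣p∪q∣≤∣p∣+∣q∣ p q)
∣p∪q∣≤∣p∣+∣q∣ (Sub.outside ∷ p) (Sub.inside ∷ q)  =
  ℕₚ.≤-trans (s≤s (∣p∪q∣≤∣p∣+∣q∣ p q)) (ℕₚ.≤-reflexive (≡-sym (ℕₚ.+-suc ∣ p ∣ ∣ q ∣)))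
∣p∪q∣≤∣p∣+∣q∣ (Sub.outside ∷ p) (Sub.outside ∷ q) = ∣p∪q∣≤∣p∣+∣q∣ p q

∣⁅x⁆∪⁅y⁆∣≤2 : ∀ {m} (x y : Fin m) → ∣ ⁅ x ⁆ ∪ ⁅ y ⁆ ∣ ≤ 2
∣⁅x⁆∪⁅y⁆∣≤2 x y =
  ℕₚ.≤-trans (∣p∪q∣≤∣p∣+∣q∣ ⁅ x ⁆ ⁅ y ⁆) (ℕₚ.≤-reflexive (cong₂ _+_ (Subsetₚ.∣⁅x⁆∣≡1 x) (Subsetₚ.∣⁅x⁆∣≡1 y)))

module _ (K : Graph) where

  private
    ∣p∪∅∣≤ : ∀ {b} (p : Subset (n K)) → ∣ p ∣ ≤ b → ∣ p ∪ ∅ ∣ ≤ b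
    ∣p∪∅∣≤ {b} p = subst (_≤ b) (≡-sym (cong ∣_∣ (Subsetₚ.∪-identityʳ p)))
    ∣∅∪p∣≤ : ∀ {b} (p : Subset (n K)) → ∣ p ∣ ≤ b → ∣ ∅ ∪ p ∣ ≤ b
    ∣∅∪p∣≤ {b} p = subst (_≤ b) (≡-sym (cong ∣_∣ (Subsetₚ.∪-identityˡ p)))
    ∣∅∣≤1 : ∣ ∅ {n K} ∣ ≤ 1
    ∣∅∣≤1 = ℕₚ.≤-trans (ℕₚ.≤-reflexive (Subsetₚ.∣⊥∣≡0 (n K))) z≤n
    ∣⁅u⁆∣≤1 : ∀ (u : Fin (n K)) → ∣ ⁅ u ⁆ ∣ ≤ 1
    ∣⁅u⁆∣≤1 u = ℕₚ.≤-reflexive (Subsetₚ.∣⁅x⁆∣≡1 u)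
    ∉⁅⁆ : ∀ {z u : Fin (n K)} → z ∉ ⁅ u ⁆ → z ≢ u
    ∉⁅⁆ {u = u} z∉ refl = z∉ (Subsetₚ.x∈⁅x⁆ u)
    ∈⁅x⁆∪⁅y⁆ˡ : ∀ (x y : Fin (n K)) → x Sub.∈ ⁅ x ⁆ ∪ ⁅ y ⁆
    ∈⁅x⁆∪⁅y⁆ˡ x y = Subsetₚ.x∈p∪q⁺ (inj₁ (Subsetₚ.x∈⁅x⁆ x))
    ∈⁅x⁆∪⁅y⁆ʳ : ∀ (x y : Fin (n K)) → y Sub.∈ ⁅ x ⁆ ∪ ⁅ y ⁆
    ∈⁅x⁆∪⁅y⁆ʳ x y = Subsetₚ.x∈p∪q⁺ (inj₂ (Subsetₚ.x∈⁅x⁆ y))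
    ∅-disjointˡ : ∀ Y → Disjoint {n K} ∅ Y
    ∅-disjointˡ _ _ i∈∅ = contradiction i∈∅ Subsetₚ.∉⊥
    ∅-disjointʳ : ∀ X → Disjoint {n K} X ∅
    ∅-disjointʳ _ _ _ = Subsetₚ.∉⊥

  EA₃⇒EA₂ : EA 3 K → EA 2 K
  EA₃⇒EA₂ ea X Y disjoint small = ea X Y disjoint (ℕₚ.m≤n⇒m≤1+n small)

  EA₂⇒vertex : EA 2 K → Fin (n K)
  EA₂⇒vertex ea = proj₁ (ea ∅ ∅ (∅-disjointʳ ∅) (s≤s (∣p∪∅∣≤ ∅ ∣∅∣≤1)))

  EA₂⇒neighbour : EA 2 K → ∀ u → ∃[ z ] z ≢ u × adj K z u ≡ true
  EA₂⇒neighbour ea u with z , z∉X , _ , z~X , _ ← ea ⁅ u ⁆ ∅ (∅-disjointʳ _) (s≤s (∣p∪∅∣≤ ⁅ u ⁆ (∣⁅u⁆∣≤1 u))) =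
    z , ∉⁅⁆ z∉X , z~X u (Subsetₚ.x∈⁅x⁆ u)

  EA₂⇒non-neighbour : EA 2 K → ∀ u → ∃[ z ] z ≢ u × adj K z u ≡ false
  EA₂⇒non-neighbour ea u with z , _ , z∉Y , _ , z≁Y ← ea ∅ ⁅ u ⁆ (∅-disjointˡ _) (s≤s (∣∅∪p∣≤ ⁅ u ⁆ (∣⁅u⁆∣≤1 u))) =
    z , ∉⁅⁆ z∉Y , z≁Y u (Subsetₚ.x∈⁅x⁆ u)

  EA₃⇒common-neighbour : EA 3 K → ∀ x y → ∃[ z ] adj K z x ≡ true × adj K z y ≡ true
  EA₃⇒common-neighbour ea x y
    with z , _ , _ , z~X , _ ← ea (⁅ x ⁆ ∪ ⁅ y ⁆) ∅ (∅-disjointʳ _) (s≤s (∣p∪∅∣≤ (⁅ x ⁆ ∪ ⁅ y ⁆) (∣⁅x⁆∪⁅y⁆∣≤2 x y))) =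
    z , z~X x (∈⁅x⁆∪⁅y⁆ˡ x y) , z~X y (∈⁅x⁆∪⁅y⁆ʳ x y)

  EA₃⇒common-non-neighbour : EA 3 K → ∀ x y → ∃[ z ] z ≢ x × z ≢ y × adj K z x ≡ false × adj K z y ≡ false
  EA₃⇒common-non-neighbour ea x y
    with z , _ , z∉Y , _ , z≁Y ← ea ∅ (⁅ x ⁆ ∪ ⁅ y ⁆) (∅-disjointˡ _) (s≤s (∣∅∪p∣≤ (⁅ x ⁆ ∪ ⁅ y ⁆) (∣⁅x⁆∪⁅y⁆∣≤2 x y))) =
    z , ∉⁅⁆ (z∉Y ∘ Subsetₚ.x∈p∪q⁺ ∘ inj₁) , ∉⁅⁆ (z∉Y ∘ Subsetₚ.x∈p∪q⁺ ∘ inj₂) ,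
    z≁Y x (∈⁅x⁆∪⁅y⁆ˡ x y) , z≁Y y (∈⁅x⁆∪⁅y⁆ʳ x y)

EA₃⇒P4⊏ : ∀ {K} → EA 3 K → P4 ⊏ K
EA₃⇒P4⊏ {K} ea = HasP4⇒P4⊏ (decidable-stable (hasP4? K) λ P4-free →
  z≢u (P4-free-bi-connected⇒subsingleton P4-free U? connected co-connected {z} {u} tt tt))
  where
  module C  = Connectivity K U U?
  module Cᶜ = Connectivity (complement K) U U?
  ea₂ : EA 2 K
  ea₂ = EA₃⇒EA₂ K ea
  u z : Fin (n K)
  u = EA₂⇒vertex K ea₂
  z = proj₁ (EA₂⇒neighbour K ea₂ u)
  z≢u : z ≢ u
  z≢u = proj₁ (proj₂ (EA₂⇒neighbour K ea₂ u))
  connected : C.Connected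
  connected {x} {y} _ _ with w , wx , wy ← EA₃⇒common-neighbour K ea x y =
    C.reach-step (C.reach-step (C.reach-refl tt) tt (trans (sym K x w) wx)) tt wy
  co-connected : Cᶜ.Connected
  co-connected {x} {y} _ _ with w , w≢x , w≢y , wx , wy ← EA₃⇒common-non-neighbour K ea x y =
    Cᶜ.reach-step (Cᶜ.reach-step (Cᶜ.reach-refl tt) tt (complement-edge⁺ K (w≢x ∘ ≡-sym) (trans (sym K x w) wx))) tt
      (complement-edge⁺ K w≢y wy)

data AtomicType : Set where
  unassigned equal adjacent apart : AtomicType

atomicType : (K : Graph) → Maybe (Fin (n K)) → Maybe (Fin (n K)) → AtomicType
atomicType K (just u) (just w) with u ≟ᶠ w | adj K u w
... | yes _ | _     = equal
... | no _  | true  = adjacent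
... | no _  | false = apart
atomicType K _ _ = unassigned

module _ (K : Graph) where

  atomicType-equal : ∀ u → atomicType K (just u) (just u) ≡ equal
  atomicType-equal u with u ≟ᶠ u
  ... | yes _  = refl
  ... | no u≢u = contradiction refl u≢u

  atomicType-adjacent : ∀ {u w} → u ≢ w → adj K u w ≡ true → atomicType K (just u) (just w) ≡ adjacent
  atomicType-adjacent {u} {w} u≢w uw with u ≟ᶠ w | adj K u w
  ... | yes u≡w | _    = contradiction u≡w u≢w
  ... | no _    | true = refl

  atomicType-apart : ∀ {u w} → u ≢ w → adj K u w ≡ false → atomicType K (just u) (just w) ≡ apart
  atomicType-apart {u} {w} u≢w uw with u ≟ᶠ w | adj K u w
  ... | yes u≡w | _     = contradiction u≡w u≢w
  ... | no _    | false = refl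

  atomicType-sym : ∀ m m′ → atomicType K m m′ ≡ atomicType K m′ m
  atomicType-sym (just u) (just w) with u ≟ᶠ w | w ≟ᶠ u | adj K u w in uw | adj K w u in wu
  ... | yes _   | yes _   | _     | _     = refl
  ... | yes u≡w | no w≢u  | _     | _     = contradiction (≡-sym u≡w) w≢u
  ... | no u≢w  | yes w≡u | _     | _     = contradiction (≡-sym w≡u) u≢w
  ... | no _    | no _    | true  | true  = refl
  ... | no _    | no _    | false | false = refl
  ... | no _    | no _    | true  | false = contradiction (trans (≡-sym uw) (trans (sym K u w) wu)) λ ()
  ... | no _    | no _    | false | true  = contradiction (trans (≡-sym wu) (trans (sym K w u) uw)) λ ()
  atomicType-sym (just _) nothing  = refl
  atomicType-sym nothing  (just _) = refl
  atomicType-sym nothing  nothing  = refl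

  Sat-≐⇔equal : ∀ ρ x y → Sat K (x ≐ y) ρ ⇔ (atomicType K (ρ x) (ρ y) ≡ equal)
  Sat-≐⇔equal ρ x y with ρ x | ρ y
  ... | just u  | just w with u ≟ᶠ w | adj K u w
  ...   | yes u≡w | _     = mk⇔ (λ _ → refl) (λ _ → u≡w)
  ...   | no u≢w  | true  = mk⇔ (λ u≡w → contradiction u≡w u≢w) λ ()
  ...   | no u≢w  | false = mk⇔ (λ u≡w → contradiction u≡w u≢w) λ ()
  Sat-≐⇔equal ρ x y | just _  | nothing = mk⇔ (λ ()) λ ()
  Sat-≐⇔equal ρ x y | nothing | _       = mk⇔ (λ ()) λ ()

  Sat-~⇔adjacent : ∀ ρ x y → Sat K (x ~' y) ρ ⇔ (atomicType K (ρ x) (ρ y) ≡ adjacent)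
  Sat-~⇔adjacent ρ x y with ρ x | ρ y
  ... | just u  | just w with u ≟ᶠ w | adj K u w in uw
  ...   | yes refl | _     = mk⇔ (λ uu → contradiction (trans (≡-sym uu) (trans (≡-sym uw) (irrefl K u))) λ ()) λ ()
  ...   | no _     | true  = mk⇔ (λ _ → refl) (λ _ → refl)
  ...   | no _     | false = mk⇔ (λ ()) λ ()
  Sat-~⇔adjacent ρ x y | just _  | nothing = mk⇔ (λ ()) λ ()
  Sat-~⇔adjacent ρ x y | nothing | _       = mk⇔ (λ ()) λ ()

EA₂-extension : ∀ K L → EA 2 L → ∀ m m′ → atomicType K m m ≡ atomicType L m′ m′ →
  ∀ v → ∃[ w ] atomicType K (just v) m ≡ atomicType L (just w) m′
EA₂-extension K L ea nothing  nothing   _  v = EA₂⇒vertex L ea , refl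
EA₂-extension K L ea nothing  (just u′) eq v = contradiction (trans eq (atomicType-equal L u′)) λ ()
EA₂-extension K L ea (just u) nothing   eq v = contradiction (trans (≡-sym (atomicType-equal K u)) eq) λ ()
EA₂-extension K L ea (just u) (just u′) _  v with v ≟ᶠ u | adj K v u
... | yes _ | _     = u′ , ≡-sym (atomicType-equal L u′)
... | no _  | true  = let z , z≢u′ , zu′ = EA₂⇒neighbour L ea u′ in z , ≡-sym (atomicType-adjacent L z≢u′ zu′)
... | no _  | false = let z , z≢u′ , zu′ = EA₂⇒non-neighbour L ea u′ in z , ≡-sym (atomicType-apart L z≢u′ zu′)

module TwoVariables {G H : Graph} (eaG : EA 2 G) (eaH : EA 2 H) (p q : Var) where

  Among : Pred Var 0ℓ
  Among x = x ≡ p ⊎ x ≡ q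

  Agree : Assign (n G) → Assign (n H) → Set
  Agree ρ σ = ∀ {u w} → Among u → Among w → atomicType G (ρ u) (ρ w) ≡ atomicType H (σ u) (σ w)

  partner : Var → Var
  partner x with x ℕ.≟ p
  ... | yes _ = q
  ... | no _  = p

  partner-among : ∀ x → Among (partner x)
  partner-among x with x ℕ.≟ p
  ... | yes _ = inj₂ refl
  ... | no _  = inj₁ refl

  partner-unique : ∀ {x y} → Among x → Among y → y ≢ x → y ≡ partner x
  partner-unique {x} ax ay y≢x with x ℕ.≟ p | ay
  ... | yes refl | inj₁ refl = contradiction refl y≢x
  ... | yes _    | inj₂ y≡q = y≡q
  ... | no _     | inj₁ y≡p = y≡p
  ... | no x≢p   | inj₂ refl = [ (λ x≡p → contradiction x≡p x≢p) , (λ x≡q → contradiction (≡-sym x≡q) y≢x) ]′ ax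

  agree-update : ∀ {ρ σ x v w} → Agree ρ σ → Among x →
    atomicType G (just v) (ρ (partner x)) ≡ atomicType H (just w) (σ (partner x)) → Agree (update ρ x v) (update σ x w)
  agree-update {ρ} {σ} {x} {v} {w} agree ax vw {u} {u′} au au′ with u ℕ.≟ x | u′ ℕ.≟ x
  ... | yes _   | yes _ = trans (atomicType-equal G v) (≡-sym (atomicType-equal H w))
  ... | yes _   | no u′≢x rewrite partner-unique ax au′ u′≢x = vw
  ... | no u≢x  | yes _ rewrite partner-unique ax au u≢x =
    trans (atomicType-sym G (ρ (partner x)) (just v)) (trans vw (atomicType-sym H (just w) (σ (partner x))))
  ... | no _    | no _ = agree au au′

  private
    atomic : ∀ {A B : Set} {t t′ c : AtomicType} → A ⇔ (t ≡ c) → B ⇔ (t′ ≡ c) → t ≡ t′ → A ⇔ B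
    atomic A⇔ B⇔ t≡t′ = mk⇔ (Equivalence.from B⇔ ∘ trans (≡-sym t≡t′) ∘ Equivalence.to A⇔)
                            (Equivalence.from A⇔ ∘ trans t≡t′ ∘ Equivalence.to B⇔)
    open Equivalence

  preserves : ∀ φ → All Among (vars φ) → ∀ {ρ σ} → Agree ρ σ → Sat G φ ρ ⇔ Sat H φ σ
  preserves (x ≐ y)  (ax ∷ ay ∷ []) {ρ} {σ} agree = atomic (Sat-≐⇔equal G ρ x y) (Sat-≐⇔equal H σ x y) (agree ax ay)
  preserves (x ~' y) (ax ∷ ay ∷ []) {ρ} {σ} agree = atomic (Sat-~⇔adjacent G ρ x y) (Sat-~⇔adjacent H σ x y) (agree ax ay)
  preserves (¬' φ) among agree = let e = preserves φ among agree in
    mk⇔ (λ ¬s t → ¬s (from e t)) (λ ¬t s → ¬t (to e s))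
  preserves (φ ∧' ψ) among agree =
    let e₁ = preserves φ (++⁻ˡ (vars φ) among) agree ; e₂ = preserves ψ (++⁻ʳ (vars φ) among) agree in
    mk⇔ (Product.map (to e₁) (to e₂)) (Product.map (from e₁) (from e₂))
  preserves (φ ∨' ψ) among agree =
    let e₁ = preserves φ (++⁻ˡ (vars φ) among) agree ; e₂ = preserves ψ (++⁻ʳ (vars φ) among) agree in
    mk⇔ (Sum.map (to e₁) (to e₂)) (Sum.map (from e₁) (from e₂))
  preserves (∃' x φ) (ax ∷ among) {ρ} {σ} agree = mk⇔
    (λ (v , s) → let w , vw = EA₂-extension G H eaH (ρ (partner x)) (σ (partner x)) self v in
      w , to (preserves φ among (agree-update agree ax vw)) s)
    (λ (w , s) → let v , wv = EA₂-extension H G eaG (σ (partner x)) (ρ (partner x)) (≡-sym self) w in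
      v , from (preserves φ among (agree-update agree ax (≡-sym wv))) s)
    where self = agree (partner-among x) (partner-among x)
  preserves (∀' x φ) (ax ∷ among) {ρ} {σ} agree = mk⇔
    (λ s w → let v , wv = EA₂-extension H G eaG (σ (partner x)) (ρ (partner x)) (≡-sym self) w in
      to (preserves φ among (agree-update agree ax (≡-sym wv))) (s v))
    (λ s v → let w , vw = EA₂-extension G H eaH (ρ (partner x)) (σ (partner x)) self v in
      from (preserves φ among (agree-update agree ax vw)) (s w))
    where self = agree (partner-among x) (partner-among x)

at-most-two : ∀ (xs : List Var) → length xs ≤ 2 → ∃[ p ] ∃[ q ] All (λ z → z ≡ p ⊎ z ≡ q) xs
at-most-two []          _ = 0 , 0 , []
at-most-two (x ∷ [])     _ = x , x , inj₁ refl ∷ []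
at-most-two (x ∷ y ∷ []) _ = x , y , inj₁ refl ∷ inj₂ refl ∷ []
at-most-two (_ ∷ _ ∷ _ ∷ _) (s≤s (s≤s ()))

EA₂⇒¬W≤2 : ∀ {G H} → EA 2 G → EA 2 H → ¬ W≤ G H 2
EA₂⇒¬W≤2 {G} {H} eaG eaH (φ , _ , width≤2 , distinguishes)
  with p , q , among ← at-most-two (deduplicate ℕ._≟_ (vars φ)) width≤2 =
  [ (λ (g , ¬h) → ¬h (to equivalent g)) , (λ (¬g , h) → ¬g (from equivalent h)) ]′ distinguishes
  where
  open TwoVariables eaG eaH p q
  open Equivalence
  equivalent : G ⊨ φ ⇔ H ⊨ φ
  equivalent = preserves φ (All.tabulate λ x∈ → All.lookup among (∈-deduplicate⁺ ℕ._≟_ x∈)) λ _ _ → refl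

allSubsets? : ∀ {m} {P : Pred (Subset m) 0ℓ} → Decidable P → Dec (∀ X → P X)
allSubsets? P? with Subsetₚ.anySubset? (¬? ∘ P?)
... | yes (X , ¬PX) = no λ all → ¬PX (all X)
... | no ¬any       = yes λ X → decidable-stable (P? X) λ ¬PX → ¬any (X , ¬PX)

EAge2? : ∀ k K → Dec (EAge2 k K)
EAge2? k K = allSubsets? λ X → allSubsets? λ Y →
  all? (λ i → (i Subsetₚ.∈? X) →-dec ¬? (i Subsetₚ.∈? Y)) →-dec (suc ∣ X ∪ Y ∣ ℕ.≤? k) →-dec
  any? λ z → ¬? (z Subsetₚ.∈? X) ×-dec ¬? (z Subsetₚ.∈? Y) ×-dec
    all? (λ x → (x Subsetₚ.∈? X) →-dec (adj K z x Boolₚ.≟ true)) ×-dec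
    all? (λ y → (y Subsetₚ.∈? Y) →-dec (adj K z y Boolₚ.≟ false))

P4⊏⇒4≤n : ∀ {K} → P4 ⊏ K → 4 ≤ n K
P4⊏⇒4≤n (_ , injective , _) = injective⇒≤ injective

K₁ : Graph
K₁ = record { n = 1 ; adj = λ _ _ → false ; sym = λ _ _ → refl ; irrefl = λ _ → refl }

matched : Fin 4 → Fin 4
matched 0F = 1F
matched 1F = 0F
matched 2F = 3F
matched 3F = 2F

2K₂ : Graph
2K₂ = record
  { n = 4
  ; adj = λ i j → ⌊ matched i ≟ᶠ j ⌋
  ; sym = toWitness {a? = all? λ i → all? λ j → ⌊ matched i ≟ᶠ j ⌋ Boolₚ.≟ ⌊ matched j ≟ᶠ i ⌋} tt
  ; irrefl = toWitness {a? = all? λ i → ⌊ matched i ≟ᶠ i ⌋ Boolₚ.≟ false} tt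
  }

2K₂-P4-free : ¬ P4 ⊏ 2K₂
2K₂-P4-free = toWitnessFalse {a? = hasP4? 2K₂} tt ∘ P4⊏⇒HasP4

2K₂-EA₂ : EA 2 2K₂
2K₂-EA₂ = toWitness {a? = EAge2? 2 2K₂} tt

P4-EA₂ : EA 2 P4
P4-EA₂ = toWitness {a? = EAge2? 2 P4} tt

P4⊏P4 : P4 ⊏ P4
P4⊏P4 = (λ i → i) , (λ e → e) , λ _ _ → refl

EA-below-3-not-forcing : (k : ℕ) → 1 ≤ k → k < 3 → ¬ ForcesInduced k P4
EA-below-3-not-forcing 1 _ _ forces = contradiction (P4⊏⇒4≤n {K₁} (forces K₁ (s≤s z≤n))) λ { (s≤s ()) }
EA-below-3-not-forcing 2 _ _ forces = 2K₂-P4-free (forces 2K₂ 2K₂-EA₂)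
EA-below-3-not-forcing (suc (suc (suc _))) _ (s≤s (s≤s (s≤s ())))

theorem4p3 : (((G H : Graph) → P4 ⊏ G → ¬ (P4 ⊏ H) → W≤ G H 3)
    × Σ Graph (λ G → Σ Graph (λ H → P4 ⊏ G × ¬ (P4 ⊏ H) × ¬ W≤ G H 2)))
    × (ForcesInduced 3 P4 × ((k : ℕ) → 1 ≤ k → k < 3 → ¬ ForcesInduced k P4))
theorem4p3 =
  ( ( P4-vs-P4-free⇒W≤3
    , P4 , 2K₂ , P4⊏P4 , 2K₂-P4-free , EA₂⇒¬W≤2 P4-EA₂ 2K₂-EA₂ )
  , ( (λ G → EA₃⇒P4⊏ {G})
    , EA-below-3-not-forcing ) )
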